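{- For every $n\geq 0$, the colorful exchange graph $\mathcal{H}^{c}_n$ of a centrally symmetric convex $(2n+4)$-gon $K$ is connected.
   Context: Let $K$ be a centrally symmetric convex $(2n+4)$-gon with center $o$. A diagonal of $K$ is central if it passes through $o$. Consider only triangulations of $K$ that are centrally symmetric with respect to $o$; each has exactly one central diagonal, and its other $2n$ diagonals form $n$ centrally symmetric pairs. A colored (centrally symmetric) triangulation assigns to each non-central diagonal a color from an $n$-element set $C(K)$ so that the two diagonals of a symmetric pair get the same color and diagonals from distinct pairs get distinct colors; the central diagonal is uncolored. A flip either replaces the central diagonal by the other diagonal of the quadrilateral formed by its two adjacent triangles (which is again central), or simultaneously flips both diagonals of a centrally symmetric pair, preserving their color. $\mathcal{H}^{c}_n$ is the graph whose vertices are the colored centrally symmetric triangulations of $K$, two being adjacent iff one is obtained from the other by a single such flip. -}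

module Defs where

open import Data.Nat using (ℕ; suc; _+_; _*_; _<_; NonZero)
open import Data.Nat.DivMod using (_%_; m%n<n)
open import Data.Fin using (Fin; toℕ; fromℕ<)
open import Data.Product using (Σ; _×_; _,_; ∃; ∃-syntax)
open import Data.Sum using (_⊎_)
open import Relation.Nullary using (¬_)
open import Relation.Binary.PropositionalEquality using (_≡_; _≢_)

size : ℕ → ℕ
size n = suc (suc (suc (suc (2 * n))))

module Polygon (n : ℕ) where

  -- Number of vertices of the polygon K : 2n+4.  Vertices are Fin (size n),
  -- labelled 0,1,…,2n+3 in cyclic (convex-position) order.

  Vert : Set
  Vert = Fin (size n)

  nextV : Vert → Vert
  nextV i = fromℕ< (m%n<n (toℕ i + 1) (size n))

  -- central symmetry about o : i ↦ i + (n+2) mod (2n+4)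
  σ : Vert → Vert
  σ i = fromℕ< (m%n<n (toℕ i + (n + 2)) (size n))

  IsDiag : Vert → Vert → Set
  IsDiag i j = i ≢ j × j ≢ nextV i × i ≢ nextV j

  InOpen : Vert → Vert → Vert → Set
  InOpen x i j = (toℕ i < toℕ x × toℕ x < toℕ j) ⊎ (toℕ j < toℕ x × toℕ x < toℕ i)

  -- the segments {i,j} and {k,l} cross (in their relative interiors)
  Cross : Vert → Vert → Vert → Vert → Set
  Cross i j k l =
    (k ≢ i × k ≢ j × l ≢ i × l ≢ j) ×
    ((InOpen k i j × ¬ InOpen l i j) ⊎ (¬ InOpen k i j × InOpen l i j))

  SamePair : Vert → Vert → Vert → Vert → Set
  SamePair i j k l = (i ≡ k × j ≡ l) ⊎ (i ≡ l × j ≡ k)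

  SameSymPair : Vert → Vert → Vert → Vert → Set
  SameSymPair i j k l = SamePair i j k l ⊎ SamePair (σ i) (σ j) k l

  -- A triangulation given by a (symmetric) support predicate on pairs:
  -- a maximal set of pairwise non-crossing diagonals.
  IsTriangulation : (Vert → Vert → Set) → Set
  IsTriangulation S =
    (∀ i j → S i j → IsDiag i j) ×
    (∀ i j k l → S i j → S k l → ¬ Cross i j k l) ×
    (∀ k l → IsDiag k l → ¬ S k l → ∃[ i ] ∃[ j ] (S i j × Cross i j k l))

  -- label of an unordered pair of vertices in a colored cs triangulation
  data Label : Set where
    none    : Label
    central : Label             -- the (uncolored) central diagonal
    col     : Fin n → Label     -- non-central diagonal with its color in C(K) = Fin n

  Labeling : Set
  Labeling = Vert → Vert → Label

  Support : Labeling → Vert → Vert → Set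
  Support L i j = L i j ≢ none

  IsColoredCST : Labeling → Set
  IsColoredCST L =
    (∀ i j → L i j ≡ L j i) ×
    IsTriangulation (Support L) ×
    (∀ i j → L (σ i) (σ j) ≡ L i j) ×
    (∀ i j → L i j ≡ central → j ≡ σ i) ×
    (∀ i j → Support L i j → j ≡ σ i → L i j ≡ central) ×
    (∀ i j k l (c : Fin n) → L i j ≡ col c → L k l ≡ col c → SameSymPair i j k l)

  record ColoredCST : Set where
    field
      lab   : Labeling
      valid : IsColoredCST lab
  open ColoredCST public

  AgreeOutside : Labeling → Labeling → (Vert → Vert → Set) → Set
  AgreeOutside L L' Exc = ∀ i j → ¬ Exc i j → L i j ≡ L' i j

  CentralFlip : Labeling → Labeling → Set
  CentralFlip L L' = Σ (Vert) λ a → Σ (Vert) λ b →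
    ¬ SamePair a (σ a) b (σ b) ×
    L a (σ a) ≡ central × L' a (σ a) ≡ none ×
    L b (σ b) ≡ none × L' b (σ b) ≡ central ×
    AgreeOutside L L' (λ i j → SamePair a (σ a) i j ⊎ SamePair b (σ b) i j)

  PairFlip : Labeling → Labeling → Set
  PairFlip L L' = Σ (Fin n) λ k → Σ (Vert) λ a → Σ (Vert) λ c →
    Σ (Vert) λ b → Σ (Vert) λ d →
    ¬ SameSymPair a c b d ×
    L a c ≡ col k × L' a c ≡ none ×
    L b d ≡ none × L' b d ≡ col k ×
    AgreeOutside L L' (λ i j → SameSymPair a c i j ⊎ SameSymPair b d i j)

  Flip : ColoredCST → ColoredCST → Set
  Flip T T' = CentralFlip (lab T) (lab T') ⊎ PairFlip (lab T) (lab T')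

  SameCST : ColoredCST → ColoredCST → Set
  SameCST T T' = ∀ i j → lab T i j ≡ lab T' i j

  data Reachable : ColoredCST → ColoredCST → Set where
    here : ∀ {T T'} → SameCST T T' → Reachable T T'
    step : ∀ {T U V} → Flip T U → Reachable U V → Reachable T V

  HcConnected : Set
  HcConnected = ∀ (T T' : ColoredCST) → Reachable T T'

module Submission where

-- Every centrally symmetric triangulation contains a central diagonal {o, σ o}.  Pair flips
-- inside the half-polygon between o and σ o make every diagonal of that half incident to o
-- (each flip adds one missing fan diagonal and keeps the others), and a central flip then moves
-- the central diagonal one vertex down; so every colored triangulation is connected to a fan
-- at vertex 0.  Such a fan is determined by the colors of its n fan diagonals {0, t + 2}, and
-- five pair flips around the pentagon spanned by two consecutive fan diagonals exchange their
-- colors.  Bubble sort, with the weight Σ t · color(t) as termination measure, therefore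
-- connects every fan at 0 to the one with colors in increasing order, and any two colored
-- triangulations are connected through this canonical one.

open import Defs
open import Data.Nat
open import Data.Nat.Properties
open import Data.Nat.DivMod
open import Data.Nat.Tactic.RingSolver using (solve-∀)
open import Data.Bool using (Bool; true; false; _∧_; _∨_; not)
open import Data.Fin using (Fin; zero; suc; toℕ; fromℕ<)
import Data.Fin.Properties as Fin
open import Data.Vec using ([]; _∷_; lookup)
import Data.Vec.Functional as Vector
open import Data.Product
open import Data.Product.Function.NonDependent.Propositional using (_×-⇔_)
open import Data.Sum
open import Data.Sum.Function.Propositional using (_⊎-⇔_)
open import Data.Empty
open import Function using (id; _∘_; case_of_; _⇔_; mk⇔; Equivalence)
open import Function.Related.TypeIsomorphisms using (→-cong-⇔; ¬-cong-⇔)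
open import Relation.Nullary
open import Relation.Nullary.Reflects using (fromEquivalence; _×-reflects_; _⊎-reflects_; _→-reflects_; ¬-reflects)
open import Relation.Unary using (Decidable)
open import Relation.Binary using (Tri; tri<; tri≈; tri>)
open import Relation.Binary.PropositionalEquality hiding ([_])

-- Order formulas

infix 7 _<'_ _≈'_
infixr 6 _∧'_
infixr 5 _∨'_
infixr 4 _⇒'_ _⇔'_

data Formula (k : ℕ) : Set where
  _<'_ _≈'_ : Fin k → Fin k → Formula k
  _∧'_ _∨'_ _⇒'_ : Formula k → Formula k → Formula k
  ¬'_ : Formula k → Formula k

_⇔'_ : ∀ {k} → Formula k → Formula k → Formula k
φ ⇔' ψ = (φ ⇒' ψ) ∧' (ψ ⇒' φ)

⟦_⟧ : ∀ {k} → Formula k → {A : Set} → (A → ℕ) → (Fin k → A) → Set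
⟦ i <' j ⟧ ν ρ = ν (ρ i) < ν (ρ j)
⟦ i ≈' j ⟧ ν ρ = ρ i ≡ ρ j
⟦ φ ∧' ψ ⟧ ν ρ = ⟦ φ ⟧ ν ρ × ⟦ ψ ⟧ ν ρ
⟦ φ ∨' ψ ⟧ ν ρ = ⟦ φ ⟧ ν ρ ⊎ ⟦ ψ ⟧ ν ρ
⟦ φ ⇒' ψ ⟧ ν ρ = ⟦ φ ⟧ ν ρ → ⟦ ψ ⟧ ν ρ
⟦ ¬' φ ⟧ ν ρ = ¬ ⟦ φ ⟧ ν ρ

SameOrder : ∀ {k} {A B : Set} → (A → ℕ) → (B → ℕ) → (Fin k → A) → (Fin k → B) → Set
SameOrder ν μ ρ τ = ∀ i j → (ν (ρ i) < ν (ρ j) ⇔ μ (τ i) < μ (τ j)) × (ρ i ≡ ρ j ⇔ τ i ≡ τ j)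

⟦⟧-invariant : ∀ {k} {A B : Set} {ν : A → ℕ} {μ : B → ℕ} {ρ τ} → SameOrder ν μ ρ τ →
               (φ : Formula k) → ⟦ φ ⟧ ν ρ ⇔ ⟦ φ ⟧ μ τ
⟦⟧-invariant same (i <' j) = proj₁ (same i j)
⟦⟧-invariant same (i ≈' j) = proj₂ (same i j)
⟦⟧-invariant same (φ ∧' ψ) = ⟦⟧-invariant same φ ×-⇔ ⟦⟧-invariant same ψ
⟦⟧-invariant same (φ ∨' ψ) = ⟦⟧-invariant same φ ⊎-⇔ ⟦⟧-invariant same ψ
⟦⟧-invariant same (φ ⇒' ψ) = →-cong-⇔ (⟦⟧-invariant same φ) (⟦⟧-invariant same ψ)
⟦⟧-invariant same (¬' φ) = ¬-cong-⇔ (⟦⟧-invariant same φ)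

eval : ∀ {k} → Formula k → (Fin k → ℕ) → Bool
eval (i <' j) ρ = ρ i <ᵇ ρ j
eval (i ≈' j) ρ = ρ i ≡ᵇ ρ j
eval (φ ∧' ψ) ρ = eval φ ρ ∧ eval ψ ρ
eval (φ ∨' ψ) ρ = eval φ ρ ∨ eval ψ ρ
eval (φ ⇒' ψ) ρ = not (eval φ ρ) ∨ eval ψ ρ
eval (¬' φ) ρ = not (eval φ ρ)

eval-reflects : ∀ {k} (φ : Formula k) ρ → Reflects (⟦ φ ⟧ id ρ) (eval φ ρ)
eval-reflects (i <' j) ρ = <ᵇ-reflects-< (ρ i) (ρ j)
eval-reflects (i ≈' j) ρ = fromEquivalence (≡ᵇ⇒≡ (ρ i) (ρ j)) (≡⇒≡ᵇ (ρ i) (ρ j))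
eval-reflects (φ ∧' ψ) ρ = eval-reflects φ ρ ×-reflects eval-reflects ψ ρ
eval-reflects (φ ∨' ψ) ρ = eval-reflects φ ρ ⊎-reflects eval-reflects ψ ρ
eval-reflects (φ ⇒' ψ) ρ = eval-reflects φ ρ →-reflects eval-reflects ψ ρ
eval-reflects (¬' φ) ρ = ¬-reflects (eval-reflects φ ρ)

reflects-true : ∀ {P : Set} {b} → Reflects P b → b ≡ true → P
reflects-true (ofʸ p) _ = p

allBelow : ℕ → (ℕ → Bool) → Bool
allBelow zero f = true
allBelow (suc m) f = f m ∧ allBelow m f

allBelow-sound : ∀ m f → allBelow m f ≡ true → ∀ v → v < m → f v ≡ true
allBelow-sound (suc m) f all v v<1+m with f m in fm | v ≟ m
... | true | yes refl = fm
... | true | no v≢m = allBelow-sound m f all v (≤∧≢⇒< (≤-pred v<1+m) v≢m)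

allAssignments : (K k : ℕ) → ((Fin k → ℕ) → Bool) → Bool
allAssignments K zero g = g (λ ())
allAssignments K (suc k) g = allBelow K (λ v → allAssignments K k (λ ρ → g (v Vector.∷ ρ)))

allAssignments-sound : ∀ K k g → allAssignments K k g ≡ true →
                       (ρ : Fin k → ℕ) → (∀ i → ρ i < K) → Σ (Fin k → ℕ) λ ρ' → (∀ i → ρ' i ≡ ρ i) × g ρ' ≡ true
allAssignments-sound K zero g all ρ _ = (λ ()) , (λ ()) , all
allAssignments-sound K (suc k) g all ρ ρ<K
  with allAssignments-sound K k (λ τ → g (ρ zero Vector.∷ τ))
         (allBelow-sound K _ all (ρ zero) (ρ<K zero)) (ρ ∘ suc) (ρ<K ∘ suc)
... | τ , τ≗ , gτ = ρ zero Vector.∷ τ , (λ { zero → refl ; (suc i) → τ≗ i }) , gτ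

Valid : ∀ {k} → Formula k → Set
Valid {k} φ = allAssignments k k (eval φ) ≡ true

indicator : ∀ {P : Set} → Dec P → ℕ
indicator (yes _) = 1
indicator (no _) = 0

indicator-mono : ∀ {P Q : Set} (p : Dec P) (q : Dec Q) → (P → Q) → indicator p ≤ indicator q
indicator-mono (yes p) (yes _) _ = ≤-refl
indicator-mono (yes p) (no ¬q) f = contradiction (f p) ¬q
indicator-mono (no _) _ _ = z≤n

indicator-yes : ∀ {P : Set} (p : Dec P) → P → indicator p ≡ 1
indicator-yes (yes _) _ = refl
indicator-yes (no ¬p) p = contradiction p ¬p

indicator-no : ∀ {P : Set} (p : Dec P) → ¬ P → indicator p ≡ 0
indicator-no (yes p) ¬p = contradiction p ¬p
indicator-no (no _) _ = refl

indicator≤1 : ∀ {P : Set} (p : Dec P) → indicator p ≤ 1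
indicator≤1 (yes _) = ≤-refl
indicator≤1 (no _) = z≤n

rank : ∀ {k} → (Fin k → ℕ) → ℕ → ℕ
rank {zero} ρ x = 0
rank {suc k} ρ x = indicator (ρ zero <? x) + rank (ρ ∘ suc) x

rank-mono : ∀ {k} (ρ : Fin k → ℕ) {x y} → x ≤ y → rank ρ x ≤ rank ρ y
rank-mono {zero} ρ x≤y = z≤n
rank-mono {suc k} ρ x≤y =
  +-mono-≤ (indicator-mono _ _ (λ r<x → <-≤-trans r<x x≤y)) (rank-mono (ρ ∘ suc) x≤y)

rank-≤ : ∀ {k} (ρ : Fin k → ℕ) x → rank ρ x ≤ k
rank-≤ {zero} ρ x = z≤n
rank-≤ {suc k} ρ x = +-mono-≤ (indicator≤1 _) (rank-≤ (ρ ∘ suc) x)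

rank-strict : ∀ {k} (ρ : Fin k → ℕ) i {y} → ρ i < y → rank ρ (ρ i) < rank ρ y
rank-strict {suc k} ρ zero {y} ρ0<y with ρ zero <? ρ zero | ρ zero <? y
... | yes ρ0<ρ0 | _ = contradiction ρ0<ρ0 (<-irrefl refl)
... | no _ | no ¬ρ0<y = contradiction ρ0<y ¬ρ0<y
... | no _ | yes _ = s≤s (rank-mono (ρ ∘ suc) (<⇒≤ ρ0<y))
rank-strict {suc k} ρ (suc i) ρi<y =
  +-mono-≤-< (indicator-mono _ _ (λ r<ρi → <-trans r<ρi ρi<y)) (rank-strict (ρ ∘ suc) i ρi<y)

rank-< : ∀ {k} (ρ : Fin k → ℕ) i → rank ρ (ρ i) < k
rank-< {suc k} ρ zero with ρ zero <? ρ zero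
... | yes ρ0<ρ0 = contradiction ρ0<ρ0 (<-irrefl refl)
... | no _ = s≤s (rank-≤ (ρ ∘ suc) (ρ zero))
rank-< {suc k} ρ (suc i) = +-mono-≤-< (indicator≤1 _) (rank-< (ρ ∘ suc) i)

-- Replacing every value by its rank preserves the order type, so an assignment into an
-- injectively ℕ-labelled type satisfies a formula iff some assignment of values below k does.
rank-sameOrder : ∀ {k} {A : Set} (ν : A → ℕ) → (∀ {a b} → ν a ≡ ν b → a ≡ b) → (ρ : Fin k → A) →
                 SameOrder id ν (rank (ν ∘ ρ) ∘ ν ∘ ρ) ρ
rank-sameOrder ν ν-inj ρ i j = mk⇔ from<' to<' , mk⇔ from≡ to≡
  where
  r = ν ∘ ρ
  to<' : ν (ρ i) < ν (ρ j) → rank r (r i) < rank r (r j)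
  to<' = rank-strict r i
  from<' : rank r (r i) < rank r (r j) → ν (ρ i) < ν (ρ j)
  from<' ri<rj with r i <? r j
  ... | yes p = p
  ... | no ¬p = contradiction ri<rj (≤⇒≯ (rank-mono r (≮⇒≥ ¬p)))
  to≡ : ρ i ≡ ρ j → rank r (r i) ≡ rank r (r j)
  to≡ e = cong (rank r ∘ ν) e
  from≡ : rank r (r i) ≡ rank r (r j) → ρ i ≡ ρ j
  from≡ e with <-cmp (r i) (r j)
  ... | tri< p _ _ = contradiction e (<⇒≢ (rank-strict r i p))
  ... | tri≈ _ q _ = ν-inj q
  ... | tri> _ _ p = contradiction (sym e) (<⇒≢ (rank-strict r j p))

valid⇒⟦⟧ : ∀ {k} (φ : Formula k) → Valid φ → {A : Set} (ν : A → ℕ) →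
           (∀ {a b} → ν a ≡ ν b → a ≡ b) → ∀ ρ → ⟦ φ ⟧ ν ρ
valid⇒⟦⟧ {k} φ valid ν ν-inj ρ
  with allAssignments-sound k k _ valid (rank (ν ∘ ρ) ∘ ν ∘ ρ) (rank-< (ν ∘ ρ))
... | τ , τ≗ , τ⊨φ =
  Equivalence.to (⟦⟧-invariant {ν = id} {μ = ν} same φ)
    (Equivalence.to (⟦⟧-invariant {ν = id} {μ = id} pointwise φ) (reflects-true (eval-reflects φ τ) τ⊨φ))
  where
  pointwise : SameOrder id id τ (rank (ν ∘ ρ) ∘ ν ∘ ρ)
  pointwise i j = mk⇔ (subst₂ _<_ (τ≗ i) (τ≗ j)) (subst₂ _<_ (sym (τ≗ i)) (sym (τ≗ j))) ,
                  mk⇔ (λ e → trans (sym (τ≗ i)) (trans e (τ≗ j))) (λ e → trans (τ≗ i) (trans e (sym (τ≗ j))))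
  same : SameOrder id ν (rank (ν ∘ ρ) ∘ ν ∘ ρ) ρ
  same = rank-sameOrder ν ν-inj ρ

x₀ : ∀ {k} → Fin (1 + k)
x₁ : ∀ {k} → Fin (2 + k)
x₂ : ∀ {k} → Fin (3 + k)
x₃ : ∀ {k} → Fin (4 + k)
x₄ : ∀ {k} → Fin (5 + k)
x₅ : ∀ {k} → Fin (6 + k)
x₀ = zero
x₁ = suc zero
x₂ = suc (suc zero)
x₃ = suc (suc (suc zero))
x₄ = suc (suc (suc (suc zero)))
x₅ = suc (suc (suc (suc (suc zero))))

-- Under ⟦_⟧ toℕ these are, definitionally, Polygon.InOpen, Polygon.Cross and Polygon.SamePair.
InOpen' : ∀ {k} → Fin k → Fin k → Fin k → Formula k
InOpen' x i j = (i <' x ∧' x <' j) ∨' (j <' x ∧' x <' i)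

Cross' : ∀ {k} → Fin k → Fin k → Fin k → Fin k → Formula k
Cross' i j k l = (¬' (k ≈' i) ∧' ¬' (k ≈' j) ∧' ¬' (l ≈' i) ∧' ¬' (l ≈' j)) ∧'
                 ((InOpen' k i j ∧' ¬' InOpen' l i j) ∨' (¬' InOpen' k i j ∧' InOpen' l i j))

SamePair' : ∀ {k} → Fin k → Fin k → Fin k → Fin k → Formula k
SamePair' i j k l = (i ≈' k ∧' j ≈' l) ∨' (i ≈' l ∧' j ≈' k)

Cyclic' : ∀ {k} → Fin k → Fin k → Fin k → Formula k
Cyclic' a b c = (a <' b ∧' b <' c) ∨' (b <' c ∧' c <' a) ∨' (c <' a ∧' a <' b)

Alternating' : ∀ {k} → Fin k → Fin k → Fin k → Fin k → Formula k
Alternating' i j k l =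
  (¬' (i ≈' j) ∧' ¬' (i ≈' k) ∧' ¬' (i ≈' l) ∧' ¬' (j ≈' k) ∧' ¬' (j ≈' l) ∧' ¬' (k ≈' l)) ∧'
  ((Cyclic' i k j ∧' ¬' Cyclic' i l j) ∨' (¬' Cyclic' i k j ∧' Cyclic' i l j))

-- The order relations between points x, y and their images X, Y under a map that shifts the
-- lower half of the polygon up and the upper half down; the Booleans tell which of x, y are low.
Halves' : ∀ {k} → Bool → Bool → Fin k → Fin k → Fin k → Fin k → Formula k
Halves' true true x y X Y = (x <' y ⇔' X <' Y) ∧' (y <' x ⇔' Y <' X)
Halves' false false x y X Y = (x <' y ⇔' X <' Y) ∧' (y <' x ⇔' Y <' X)
Halves' true false x y X Y = x <' y ∧' Y <' X
Halves' false true x y X Y = y <' x ∧' X <' Y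

HalvesCyclic' : Bool → Bool → Bool → Formula 6
HalvesCyclic' a b c = Halves' a b x₀ x₁ x₃ x₄ ⇒' Halves' a c x₀ x₂ x₃ x₅ ⇒' Halves' b c x₁ x₂ x₄ x₅ ⇒'
                      (Cyclic' x₀ x₁ x₂ ⇔' Cyclic' x₃ x₄ x₅)

halvesCyclic-valid : ∀ a b c → Valid (HalvesCyclic' a b c)
halvesCyclic-valid true true true = refl
halvesCyclic-valid true true false = refl
halvesCyclic-valid true false true = refl
halvesCyclic-valid true false false = refl
halvesCyclic-valid false true true = refl
halvesCyclic-valid false true false = refl
halvesCyclic-valid false false true = refl
halvesCyclic-valid false false false = refl

greatestBelow : {P : ℕ → Set} → Decidable P → ∀ {lo hi} → P lo → lo < hi →
                ∃[ x ] lo ≤ x × x < hi × P x × (∀ y → x < y → y < hi → ¬ P y)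
greatestBelow {P} P? {lo} {suc hi} Plo lo<1+hi with P? hi
... | yes Phi = hi , ≤-pred lo<1+hi , ≤-refl , Phi , λ y hi<y y<1+hi → contradiction (≤-pred y<1+hi) (<⇒≱ hi<y)
... | no ¬Phi with lo ≟ hi
...   | yes refl = contradiction Plo ¬Phi
...   | no lo≢hi with greatestBelow P? Plo (≤∧≢⇒< (≤-pred lo<1+hi) lo≢hi)
...     | x , lo≤x , x<hi , Px , above = x , lo≤x , m≤n⇒m≤1+n x<hi , Px , λ y x<y y<1+hi →
          case y ≟ hi of λ { (yes refl) → ¬Phi ; (no y≢hi) → above y x<y (≤∧≢⇒< (≤-pred y<1+hi) y≢hi) }

leastAbove : {P : ℕ → Set} → Decidable P → ∀ {lo hi} → P hi → lo < hi →
             ∃[ x ] lo < x × x ≤ hi × P x × (∀ y → lo < y → y < x → ¬ P y)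
leastAbove {P} P? {lo} {hi} Phi lo<hi with m≤n⇒∃[o]m+o≡n lo<hi
... | k , 1+lo+k≡hi = search k lo (subst P (sym 1+lo+k≡hi) Phi) 1+lo+k≡hi
  where
  search : ∀ k lo → P (suc lo + k) → suc lo + k ≡ hi → ∃[ x ] lo < x × x ≤ hi × P x × (∀ y → lo < y → y < x → ¬ P y)
  search k lo P[1+lo+k] e with P? (suc lo)
  ... | yes P[1+lo] = suc lo , ≤-refl , subst (suc lo ≤_) e (m≤m+n (suc lo) k) , P[1+lo] ,
                      λ y lo<y y<1+lo → contradiction (≤-pred y<1+lo) (<⇒≱ lo<y)
  search zero lo P[1+lo] e | no ¬P[1+lo] = contradiction (subst P (+-identityʳ (suc lo)) P[1+lo]) ¬P[1+lo]
  search (suc k) lo P[1+lo+k] e | no ¬P[1+lo]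
    with search k (suc lo) (subst P (+-suc (suc lo) k) P[1+lo+k]) (trans (sym (+-suc (suc lo) k)) e)
  ... | x , 1+lo<x , x≤hi , Px , below = x , <-trans (n<1+n lo) 1+lo<x , x≤hi , Px , λ y lo<y y<x →
        case y ≟ suc lo of λ { (yes refl) → ¬P[1+lo] ; (no y≢1+lo) → below y (≤∧≢⇒< lo<y (y≢1+lo ∘ sym)) y<x }

sum< : ℕ → (ℕ → ℕ) → ℕ
sum< zero f = 0
sum< (suc k) f = f k + sum< k f

sum<-mono-≤ : ∀ k {f g} → (∀ t → t < k → f t ≤ g t) → sum< k f ≤ sum< k g
sum<-mono-≤ zero f≤g = z≤n
sum<-mono-≤ (suc k) f≤g = +-mono-≤ (f≤g k ≤-refl) (sum<-mono-≤ k (λ t t<k → f≤g t (m≤n⇒m≤1+n t<k)))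

sum<-mono-< : ∀ k {f g} → (∀ t → t < k → f t ≤ g t) → ∀ t₀ → t₀ < k → f t₀ < g t₀ → sum< k f < sum< k g
sum<-mono-< (suc k) f≤g t₀ t₀<1+k ft₀<gt₀ with t₀ ≟ k
... | yes refl = +-mono-<-≤ ft₀<gt₀ (sum<-mono-≤ k (λ t t<k → f≤g t (m≤n⇒m≤1+n t<k)))
... | no t₀≢k = +-mono-≤-< (f≤g k ≤-refl)
                  (sum<-mono-< k (λ t t<k → f≤g t (m≤n⇒m≤1+n t<k)) t₀ (≤∧≢⇒< (≤-pred t₀<1+k) t₀≢k) ft₀<gt₀)

weight : ℕ → (ℕ → ℕ) → ℕ
weight zero f = 0
weight (suc m) f = weight m f + m * f m

weight-cong : ∀ m {f g} → (∀ t → t < m → f t ≡ g t) → weight m f ≡ weight m g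
weight-cong zero f≗g = refl
weight-cong (suc m) f≗g = cong₂ _+_ (weight-cong m (λ t t<m → f≗g t (m≤n⇒m≤1+n t<m))) (cong (m *_) (f≗g m ≤-refl))

weight-swap : ∀ j m {f g} → 2 + j ≤ m → (∀ t → t < m → t ≢ j → t ≢ suc j → g t ≡ f t) →
              g j ≡ f (suc j) → g (suc j) ≡ f j → f (suc j) < f j → weight m f < weight m g
weight-swap j m {f} {g} 2+j≤m agree gj gj+1 inversion = go m (≤⇒≤′ 2+j≤m) agree
  where
  W = weight j f
  a = f j
  b = f (suc j)
  exchanged : W + j * a + suc j * b < W + j * b + suc j * a
  exchanged = begin-strict
    W + j * a + suc j * b     ≡⟨ shape W j a b ⟩
    W + j * a + j * b + b     <⟨ +-monoʳ-< (W + j * a + j * b) inversion ⟩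
    W + j * a + j * b + a     ≡⟨ sym (shape' W j a b) ⟩
    W + j * b + suc j * a     ∎
    where
    open ≤-Reasoning
    shape : ∀ W j a b → W + j * a + suc j * b ≡ W + j * a + j * b + b
    shape = solve-∀
    shape' : ∀ W j a b → W + j * b + suc j * a ≡ W + j * a + j * b + a
    shape' = solve-∀
  go : ∀ m → 2 + j ≤′ m → (∀ t → t < m → t ≢ j → t ≢ suc j → g t ≡ f t) → weight m f < weight m g
  go .(2 + j) ≤′-refl agree = subst (λ z → weight (2 + j) f < z + j * g j + suc j * g (suc j))
    (sym (weight-cong j (λ t t<j → agree t (<-trans t<j (<-trans (n<1+n j) (n<1+n (suc j))))
                                         (<⇒≢ t<j) (<⇒≢ (<-trans t<j (n<1+n j))))))
    (subst₂ (λ u v → W + j * a + suc j * b < W + j * u + suc j * v) (sym gj) (sym gj+1) exchanged)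
  go (suc m) (≤′-step 2+j≤m) agree = subst (λ z → weight m f + m * f m < weight m g + m * z)
    (sym (agree m (n<1+n m) (λ { refl → 1+n≰n (≤-trans (n≤1+n _) (≤′⇒≤ 2+j≤m)) })
                            (λ { refl → 1+n≰n (≤′⇒≤ 2+j≤m) })))
    (+-monoˡ-< (m * f m) (go m 2+j≤m (λ t t<m → agree t (m≤n⇒m≤1+n t<m))))

weight-≤ : ∀ K m f → m ≤ K → (∀ t → t < m → f t ≤ K) → weight m f ≤ m * (K * K)
weight-≤ K zero f m≤K f≤K = z≤n
weight-≤ K (suc m) f m<K f≤K = subst (weight m f + m * f m ≤_) (+-comm (m * (K * K)) (K * K))
  (+-mono-≤ (weight-≤ K m f (<⇒≤ m<K) (λ t t<m → f≤K t (m≤n⇒m≤1+n t<m))) (*-mono-≤ (<⇒≤ m<K) (f≤K m ≤-refl)))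

increasing-bounded⇒id : ∀ K (f : ℕ → ℕ) → (∀ t → suc t < K → f t < f (suc t)) → (∀ t → t < K → f t < K) →
                        ∀ t → t < K → f t ≡ t
increasing-bounded⇒id K f increasing bounded t t<K = ≤-antisym (above t (K ∸ suc t) (m+[n∸m]≡n t<K)) (below t t<K)
  where
  below : ∀ t → t < K → t ≤ f t
  below zero _ = z≤n
  below (suc t) 1+t<K = ≤-<-trans (below t (<-trans (n<1+n t) 1+t<K)) (increasing t 1+t<K)
  above : ∀ t d → suc t + d ≡ K → f t ≤ t
  above t zero e = ≤-pred (subst (f t <_) (trans (sym e) (+-identityʳ (suc t)))
                                 (bounded t (subst (t <_) e (m≤m+n (suc t) 0))))
  above t (suc d) e = ≤-pred (<-≤-trans (increasing t 1+t<K) (above (suc t) d (trans (sym (+-suc (suc t) d)) e)))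
    where
    1+t<K : suc t < K
    1+t<K = subst (suc t <_) e (s≤s (subst (t <_) (sym (+-suc t d)) (s≤s (m≤m+n t d))))

size≡ : ∀ n → suc (suc (suc (suc (2 * n)))) ≡ (n + 2) + (n + 2)
size≡ = solve-∀

module Hc (n : ℕ) where
  open Polygon n

  h : ℕ
  h = n + 2

  N : ℕ
  N = size n

  N≡h+h : N ≡ h + h
  N≡h+h = size≡ n

  2≤h : 2 ≤ h
  2≤h = m≤n+m 2 n

  h<N : h < N
  h<N = subst (h <_) (sym N≡h+h) (m<m+n h (≤-trans (s≤s z≤n) 2≤h))

  ν : Vert → ℕ
  ν = toℕ

  ν<N : ∀ i → ν i < N
  ν<N = Fin.toℕ<n

  ν-injective : ∀ {i j} → ν i ≡ ν j → i ≡ j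
  ν-injective = Fin.toℕ-injective

  vertex : ℕ → Vert
  vertex m = fromℕ< (m%n<n m N)

  ν-vertex : ∀ m → m < N → ν (vertex m) ≡ m
  ν-vertex m m<N = trans (Fin.toℕ-fromℕ< (m%n<n m N)) (m<n⇒m%n≡m m<N)

  vertex-ν : ∀ i m → ν i ≡ m → vertex m ≡ i
  vertex-ν i _ refl = ν-injective (ν-vertex (ν i) (ν<N i))

  ν-σ : ∀ i → ν (σ i) ≡ (ν i + h) % N
  ν-σ i = Fin.toℕ-fromℕ< _

  ν-σ-low : ∀ i → ν i < h → ν (σ i) ≡ ν i + h
  ν-σ-low i i<h = trans (ν-σ i) (m<n⇒m%n≡m (subst (ν i + h <_) (sym N≡h+h) (+-monoˡ-< h i<h)))

  ν-σ-high : ∀ i → h ≤ ν i → ν (σ i) + h ≡ ν i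
  ν-σ-high i h≤i = begin
    ν (σ i) + h                 ≡⟨ cong (_+ h) (ν-σ i) ⟩
    (ν i + h) % N + h           ≡⟨ cong (λ z → z % N + h) i+h≡ ⟩
    (ν i ∸ h + N) % N + h       ≡⟨ cong (_+ h) ([m+n]%n≡m%n (ν i ∸ h) N) ⟩
    (ν i ∸ h) % N + h           ≡⟨ cong (_+ h) (m<n⇒m%n≡m (≤-<-trans (m∸n≤m (ν i) h) (ν<N i))) ⟩
    ν i ∸ h + h                 ≡⟨ m∸n+n≡m h≤i ⟩
    ν i                         ∎
    where
    open ≡-Reasoning
    i+h≡ : ν i + h ≡ ν i ∸ h + N
    i+h≡ = begin
      ν i + h                   ≡⟨ cong (_+ h) (sym (m∸n+n≡m h≤i)) ⟩
      ν i ∸ h + h + h           ≡⟨ +-assoc (ν i ∸ h) h h ⟩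
      ν i ∸ h + (h + h)         ≡⟨ cong (ν i ∸ h +_) (sym N≡h+h) ⟩
      ν i ∸ h + N               ∎

  σ-low⇒high : ∀ i → ν i < h → h ≤ ν (σ i)
  σ-low⇒high i i<h = subst (h ≤_) (sym (ν-σ-low i i<h)) (m≤n+m h (ν i))

  σ-high⇒low : ∀ i → h ≤ ν i → ν (σ i) < h
  σ-high⇒low i h≤i = +-cancelʳ-< h (ν (σ i)) h (subst (_< h + h) (sym (ν-σ-high i h≤i)) (subst (ν i <_) N≡h+h (ν<N i)))

  σ-involutive : ∀ i → σ (σ i) ≡ i
  σ-involutive i with ν i <? h
  ... | yes i<h = ν-injective (+-cancelʳ-≡ h _ _ (trans (ν-σ-high (σ i) (σ-low⇒high i i<h)) (ν-σ-low i i<h)))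
  ... | no i≮h = ν-injective (trans (ν-σ-low (σ i) (σ-high⇒low i (≮⇒≥ i≮h))) (ν-σ-high i (≮⇒≥ i≮h)))

  σ-injective : ∀ {i j} → σ i ≡ σ j → i ≡ j
  σ-injective {i} {j} e = trans (sym (σ-involutive i)) (trans (cong σ e) (σ-involutive j))

  σ-no-fixpoint : ∀ i → σ i ≢ i
  σ-no-fixpoint i σi≡i with ν i <? h
  ... | yes i<h = h≢0 (+-cancelˡ-≡ (ν i) h 0 (trans (sym (ν-σ-low i i<h)) (trans (cong ν σi≡i) (sym (+-identityʳ (ν i))))))
    where h≢0 : h ≢ 0
          h≢0 h≡0 = contradiction (subst (2 ≤_) h≡0 2≤h) λ ()
  ... | no i≮h = <-irrefl (cong ν σi≡i) (σ-high⇒low-< (≮⇒≥ i≮h))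
    where σ-high⇒low-< : h ≤ ν i → ν (σ i) < ν i
          σ-high⇒low-< h≤i = <-≤-trans (σ-high⇒low i h≤i) h≤i

  ν-nextV : ∀ i → ν (nextV i) ≡ (ν i + 1) % N
  ν-nextV i = Fin.toℕ-fromℕ< _

  ν-nextV-< : ∀ i → ν i + 1 < N → ν (nextV i) ≡ ν i + 1
  ν-nextV-< i i+1<N = trans (ν-nextV i) (m<n⇒m%n≡m i+1<N)

  ν-nextV-last : ∀ i → ν i + 1 ≡ N → ν (nextV i) ≡ 0
  ν-nextV-last i i+1≡N = trans (ν-nextV i) (trans (cong (_% N) i+1≡N) (n%n≡0 N))

  σ-nextV : ∀ i → σ (nextV i) ≡ nextV (σ i)
  σ-nextV i = ν-injective (begin
    ν (σ (nextV i))             ≡⟨ ν-σ (nextV i) ⟩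
    (ν (nextV i) + h) % N       ≡⟨ cong (λ z → (z + h) % N) (ν-nextV i) ⟩
    ((ν i + 1) % N + h) % N     ≡⟨ %-absorbˡ (ν i + 1) h ⟩
    (ν i + 1 + h) % N           ≡⟨ cong (_% N) (swap-1 (ν i) h) ⟩
    (ν i + h + 1) % N           ≡⟨ sym (%-absorbˡ (ν i + h) 1) ⟩
    ((ν i + h) % N + 1) % N     ≡⟨ cong (λ z → (z + 1) % N) (sym (ν-σ i)) ⟩
    (ν (σ i) + 1) % N           ≡⟨ sym (ν-nextV (σ i)) ⟩
    ν (nextV (σ i))             ∎)
    where
    open ≡-Reasoning
    swap-1 : ∀ a b → a + 1 + b ≡ a + b + 1
    swap-1 = solve-∀
    %-absorbˡ : ∀ a b → ((a % N) + b) % N ≡ (a + b) % N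
    %-absorbˡ a b = begin
      ((a % N) + b) % N         ≡⟨ %-distribˡ-+ (a % N) b N ⟩
      (a % N % N + b % N) % N   ≡⟨ cong (λ z → (z + b % N) % N) (m%n%n≡m%n a N) ⟩
      (a % N + b % N) % N       ≡⟨ sym (%-distribˡ-+ a b N) ⟩
      (a + b) % N               ∎

  holds : ∀ {k} (φ : Formula k) → Valid φ → ∀ ρ → ⟦ φ ⟧ ν ρ
  holds φ valid = valid⇒⟦⟧ φ valid ν ν-injective

  cross-sym : ∀ {i j k l} → Cross i j k l → Cross k l i j
  cross-sym {i} {j} {k} {l} =
    holds (Cross' x₀ x₁ x₂ x₃ ⇒' Cross' x₂ x₃ x₀ x₁) refl (lookup (i ∷ j ∷ k ∷ l ∷ []))

  cross-swapˡ : ∀ {i j k l} → Cross i j k l → Cross j i k l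
  cross-swapˡ {i} {j} {k} {l} =
    holds (Cross' x₀ x₁ x₂ x₃ ⇒' Cross' x₁ x₀ x₂ x₃) refl (lookup (i ∷ j ∷ k ∷ l ∷ []))

  cross-swapʳ : ∀ {i j k l} → Cross i j k l → Cross i j l k
  cross-swapʳ {i} {j} {k} {l} =
    holds (Cross' x₀ x₁ x₂ x₃ ⇒' Cross' x₀ x₁ x₃ x₂) refl (lookup (i ∷ j ∷ k ∷ l ∷ []))

  cross-samePairˡ : ∀ {i j k l x y} → SamePair i j k l → Cross i j x y → Cross k l x y
  cross-samePairˡ (inj₁ (refl , refl)) c = c
  cross-samePairˡ (inj₂ (refl , refl)) c = cross-swapˡ c

  cross-samePairʳ : ∀ {i j k l x y} → SamePair k l x y → Cross i j k l → Cross i j x y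
  cross-samePairʳ (inj₁ (refl , refl)) c = c
  cross-samePairʳ (inj₂ (refl , refl)) c = cross-swapʳ c

  samePair⇒¬cross : ∀ {i j k l} → SamePair i j k l → ¬ Cross i j k l
  samePair⇒¬cross (inj₁ (refl , refl)) ((k≢i , _) , _) = k≢i refl
  samePair⇒¬cross (inj₂ (refl , refl)) ((_ , k≢j , _) , _) = k≢j refl

  sorted⇒cross : ∀ {p q r s} → ν p < ν q → ν q < ν r → ν r < ν s → Cross p r q s
  sorted⇒cross {p} {q} {r} {s} =
    holds (x₀ <' x₁ ⇒' x₁ <' x₂ ⇒' x₂ <' x₃ ⇒' Cross' x₀ x₂ x₁ x₃) refl (lookup (p ∷ q ∷ r ∷ s ∷ []))

  cross-quadrilateral : ∀ {a b c d x y} → Cross a c b d → Cross b d x y →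
    Cross a c x y ⊎ Cross a b x y ⊎ Cross b c x y ⊎ Cross c d x y ⊎ Cross d a x y ⊎ SamePair a c x y
  cross-quadrilateral {a} {b} {c} {d} {x} {y} =
    holds (Cross' x₀ x₂ x₁ x₃ ⇒' Cross' x₁ x₃ x₄ x₅ ⇒'
             Cross' x₀ x₂ x₄ x₅ ∨' Cross' x₀ x₁ x₄ x₅ ∨' Cross' x₁ x₂ x₄ x₅ ∨'
             Cross' x₂ x₃ x₄ x₅ ∨' Cross' x₃ x₀ x₄ x₅ ∨' SamePair' x₀ x₂ x₄ x₅)
          refl (lookup (a ∷ b ∷ c ∷ d ∷ x ∷ y ∷ []))

  cross-triangle : ∀ {v u w s t} → ν v < ν u → ν u < ν w → Cross u w s t →
    Cross v u s t ⊎ Cross v w s t ⊎ (s ≡ v × ν u < ν t × ν t < ν w) ⊎ (t ≡ v × ν u < ν s × ν s < ν w)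
  cross-triangle {v} {u} {w} {s} {t} =
    holds (x₀ <' x₁ ⇒' x₁ <' x₂ ⇒' Cross' x₁ x₂ x₃ x₄ ⇒'
             Cross' x₀ x₁ x₃ x₄ ∨' Cross' x₀ x₂ x₃ x₄ ∨'
             (x₃ ≈' x₀ ∧' x₁ <' x₄ ∧' x₄ <' x₂) ∨' (x₄ ≈' x₀ ∧' x₁ <' x₃ ∧' x₃ <' x₂))
          refl (lookup (v ∷ u ∷ w ∷ s ∷ t ∷ []))

  Edge : Vert → Vert → Set
  Edge p q = q ≡ nextV p ⊎ p ≡ nextV q

  nextV-¬cross : ∀ {p x y} → ¬ Cross p (nextV p) x y
  nextV-¬cross {p} {x} {y} ((x≢p , x≢q , y≢p , y≢q) , opens) with ν p + 1 <? N
  ... | yes p+1<N = [ nothing-between ∘ proj₁ , nothing-between ∘ proj₂ ] opens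
    where
    q≡1+p : ν (nextV p) ≡ suc (ν p)
    q≡1+p = trans (ν-nextV-< p p+1<N) (+-comm (ν p) 1)
    nothing-between : ∀ {z} → ¬ InOpen z p (nextV p)
    nothing-between (inj₁ (p<z , z<q)) = <⇒≱ p<z (≤-pred (subst (_ <_) q≡1+p z<q))
    nothing-between (inj₂ (q<z , z<p)) = <-asym z<p (<-trans (n<1+n (ν p)) (subst (_< _) q≡1+p q<z))
  ... | no p+1≮N = [ (λ (_ , ¬y∈) → ¬y∈ (inside y≢p y≢q)) , (λ (¬x∈ , _) → ¬x∈ (inside x≢p x≢q)) ] opens
    where
    N≡1+p : N ≡ suc (ν p)
    N≡1+p = ≤-antisym (≮⇒≥ (p+1≮N ∘ subst (_< N) (+-comm 1 (ν p)))) (ν<N p)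
    inside : ∀ {z} → z ≢ p → z ≢ nextV p → InOpen z p (nextV p)
    inside {z} z≢p z≢q = inj₂ (subst (_< ν z) (sym q≡0) (n≢0⇒n>0 (z≢q ∘ ν-injective ∘ (λ z≡0 → trans z≡0 (sym q≡0)))) ,
                               ≤∧≢⇒< (≤-pred (subst (ν z <_) N≡1+p (ν<N z))) (z≢p ∘ ν-injective))
      where q≡0 = ν-nextV-last p (trans (+-comm (ν p) 1) (sym N≡1+p))

  edge-¬cross : ∀ {p q x y} → Edge p q → ¬ Cross p q x y
  edge-¬cross (inj₁ refl) = nextV-¬cross
  edge-¬cross (inj₂ refl) = nextV-¬cross ∘ cross-swapˡ

  σ-halves : ∀ {k} (ρ : Fin k → Vert) x y X Y → ρ X ≡ σ (ρ x) → ρ Y ≡ σ (ρ y) →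
             (x? : Dec (ν (ρ x) < h)) (y? : Dec (ν (ρ y) < h)) → ⟦ Halves' (does x?) (does y?) x y X Y ⟧ ν ρ
  σ-halves ρ x y X Y eX eY (yes x<h) (yes y<h) rewrite eX | eY =
    ((λ x<y → subst₂ _<_ (sym (ν-σ-low (ρ x) x<h)) (sym (ν-σ-low (ρ y) y<h)) (+-monoˡ-< h x<y)) ,
     (λ σx<σy → +-cancelʳ-< h _ _ (subst₂ _<_ (ν-σ-low (ρ x) x<h) (ν-σ-low (ρ y) y<h) σx<σy))) ,
    ((λ y<x → subst₂ _<_ (sym (ν-σ-low (ρ y) y<h)) (sym (ν-σ-low (ρ x) x<h)) (+-monoˡ-< h y<x)) ,
     (λ σy<σx → +-cancelʳ-< h _ _ (subst₂ _<_ (ν-σ-low (ρ y) y<h) (ν-σ-low (ρ x) x<h) σy<σx)))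
  σ-halves ρ x y X Y eX eY (no x≮h) (no y≮h) rewrite eX | eY =
    ((λ x<y → +-cancelʳ-< h _ _ (subst₂ _<_ (sym (ν-σ-high (ρ x) h≤x)) (sym (ν-σ-high (ρ y) h≤y)) x<y)) ,
     (λ σx<σy → subst₂ _<_ (ν-σ-high (ρ x) h≤x) (ν-σ-high (ρ y) h≤y) (+-monoˡ-< h σx<σy))) ,
    ((λ y<x → +-cancelʳ-< h _ _ (subst₂ _<_ (sym (ν-σ-high (ρ y) h≤y)) (sym (ν-σ-high (ρ x) h≤x)) y<x)) ,
     (λ σy<σx → subst₂ _<_ (ν-σ-high (ρ y) h≤y) (ν-σ-high (ρ x) h≤x) (+-monoˡ-< h σy<σx)))
    where
    h≤x = ≮⇒≥ x≮h
    h≤y = ≮⇒≥ y≮h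
  σ-halves ρ x y X Y eX eY (yes x<h) (no y≮h) rewrite eX | eY =
    <-≤-trans x<h (≮⇒≥ y≮h) , <-≤-trans (σ-high⇒low (ρ y) (≮⇒≥ y≮h)) (σ-low⇒high (ρ x) x<h)
  σ-halves ρ x y X Y eX eY (no x≮h) (yes y<h) rewrite eX | eY =
    <-≤-trans y<h (≮⇒≥ x≮h) , <-≤-trans (σ-high⇒low (ρ x) (≮⇒≥ x≮h)) (σ-low⇒high (ρ y) y<h)

  Cyclic : Vert → Vert → Vert → Set
  Cyclic a b c = ⟦ Cyclic' x₀ x₁ x₂ ⟧ ν (lookup (a ∷ b ∷ c ∷ []))

  σ-cyclic : ∀ a b c → (Cyclic a b c → Cyclic (σ a) (σ b) (σ c)) × (Cyclic (σ a) (σ b) (σ c) → Cyclic a b c)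
  σ-cyclic a b c =
    holds (HalvesCyclic' (does a?) (does b?) (does c?)) (halvesCyclic-valid (does a?) (does b?) (does c?)) ρ
          (σ-halves ρ x₀ x₁ x₃ x₄ refl refl a? b?) (σ-halves ρ x₀ x₂ x₃ x₅ refl refl a? c?)
          (σ-halves ρ x₁ x₂ x₄ x₅ refl refl b? c?)
    where
    ρ = lookup (a ∷ b ∷ c ∷ σ a ∷ σ b ∷ σ c ∷ [])
    a? = ν a <? h
    b? = ν b <? h
    c? = ν c <? h

  -- Crossing depends only on the cyclic order of the four endpoints, which σ preserves.
  cross⇔alternating : ∀ i j k l → ⟦ Cross' x₀ x₁ x₂ x₃ ⇔' Alternating' x₀ x₁ x₂ x₃ ⟧ ν (lookup (i ∷ j ∷ k ∷ l ∷ []))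
  cross⇔alternating i j k l =
    holds (Cross' x₀ x₁ x₂ x₃ ⇔' Alternating' x₀ x₁ x₂ x₃) refl (lookup (i ∷ j ∷ k ∷ l ∷ []))

  σ-cross : ∀ {i j k l} → Cross i j k l → Cross (σ i) (σ j) (σ k) (σ l)
  σ-cross {i} {j} {k} {l} c =
    proj₂ (cross⇔alternating (σ i) (σ j) (σ k) (σ l)) (σ-distinct distinct , σ-alternate alternate)
    where
    distinct = proj₁ (proj₁ (cross⇔alternating i j k l) c)
    alternate = proj₂ (proj₁ (cross⇔alternating i j k l) c)
    σ-distinct : i ≢ j × i ≢ k × i ≢ l × j ≢ k × j ≢ l × k ≢ l →
                 σ i ≢ σ j × σ i ≢ σ k × σ i ≢ σ l × σ j ≢ σ k × σ j ≢ σ l × σ k ≢ σ l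
    σ-distinct (i≢j , i≢k , i≢l , j≢k , j≢l , k≢l) =
      i≢j ∘ σ-injective , i≢k ∘ σ-injective , i≢l ∘ σ-injective ,
      j≢k ∘ σ-injective , j≢l ∘ σ-injective , k≢l ∘ σ-injective
    σ-alternate : (Cyclic i k j × ¬ Cyclic i l j) ⊎ (¬ Cyclic i k j × Cyclic i l j) →
                  (Cyclic (σ i) (σ k) (σ j) × ¬ Cyclic (σ i) (σ l) (σ j)) ⊎
                  (¬ Cyclic (σ i) (σ k) (σ j) × Cyclic (σ i) (σ l) (σ j))
    σ-alternate (inj₁ (ikj , ¬ilj)) = inj₁ (proj₁ (σ-cyclic i k j) ikj , ¬ilj ∘ proj₂ (σ-cyclic i l j))
    σ-alternate (inj₂ (¬ikj , ilj)) = inj₂ (¬ikj ∘ proj₂ (σ-cyclic i k j) , proj₁ (σ-cyclic i l j) ilj)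

  samePair? : ∀ i j k l → Dec (SamePair i j k l)
  samePair? i j k l = (i Fin.≟ k ×-dec j Fin.≟ l) ⊎-dec (i Fin.≟ l ×-dec j Fin.≟ k)

  -- Flipping a diagonal of a triangulation

  samePair-refl : ∀ {i j} → SamePair i j i j
  samePair-refl = inj₁ (refl , refl)

  samePair-sym : ∀ {i j k l} → SamePair i j k l → SamePair k l i j
  samePair-sym (inj₁ (refl , refl)) = inj₁ (refl , refl)
  samePair-sym (inj₂ (refl , refl)) = inj₂ (refl , refl)

  samePair-trans : ∀ {i j k l x y} → SamePair i j k l → SamePair k l x y → SamePair i j x y
  samePair-trans (inj₁ (refl , refl)) q = q
  samePair-trans (inj₂ (refl , refl)) (inj₁ (refl , refl)) = inj₂ (refl , refl)
  samePair-trans (inj₂ (refl , refl)) (inj₂ (refl , refl)) = inj₁ (refl , refl)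

  samePair-swap : ∀ {i j k l} → SamePair i j k l → SamePair j i k l
  samePair-swap (inj₁ (refl , refl)) = inj₂ (refl , refl)
  samePair-swap (inj₂ (refl , refl)) = inj₁ (refl , refl)

  isDiag-sym : ∀ {i j} → IsDiag i j → IsDiag j i
  isDiag-sym (i≢j , j≢i+1 , i≢j+1) = i≢j ∘ sym , i≢j+1 , j≢i+1

  isDiag-samePair : ∀ {i j k l} → SamePair i j k l → IsDiag i j → IsDiag k l
  isDiag-samePair (inj₁ (refl , refl)) d = d
  isDiag-samePair (inj₂ (refl , refl)) d = isDiag-sym d

  Side : (Vert → Vert → Set) → Vert → Vert → Set
  Side S p q = Edge p q ⊎ S p q

  side-¬cross : ∀ {S p q x y} → IsTriangulation S → Side S p q → S x y → ¬ Cross p q x y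
  side-¬cross T (inj₁ e) _ = edge-¬cross e
  side-¬cross {p = p} {q} {x} {y} (_ , noncrossing , _) (inj₂ s) sxy = noncrossing p q x y s sxy

  ¬samePair : ∀ {i j k l} → (i ≢ k ⊎ j ≢ l) → (i ≢ l ⊎ j ≢ k) → ¬ SamePair i j k l
  ¬samePair i≢k⊎j≢l _ (inj₁ (i≡k , j≡l)) = [ (λ i≢k → i≢k i≡k) , (λ j≢l → j≢l j≡l) ] i≢k⊎j≢l
  ¬samePair _ i≢l⊎j≢k (inj₂ (i≡l , j≡k)) = [ (λ i≢l → i≢l i≡l) , (λ j≢k → j≢k j≡k) ] i≢l⊎j≢k

  Flipped : (Vert → Vert → Set) → Vert → Vert → Vert → Vert → Vert → Vert → Set
  Flipped S a c b d i j = SamePair b d i j ⊎ (S i j × ¬ SamePair a c i j)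

  module Flip {S : Vert → Vert → Set} {a b c d} (T : IsTriangulation S) (Sac : S a c) (ac×bd : Cross a c b d)
              (bd-diag : IsDiag b d) (ab : Side S a b) (bc : Side S b c) (cd : Side S c d) (da : Side S d a) where

    S' : Vert → Vert → Set
    S' = Flipped S a c b d

    diagonals : ∀ i j → IsDiag i j → ¬ S i j → ∃[ k ] ∃[ l ] (S k l × Cross k l i j)
    diagonals = proj₂ (proj₂ T)

    noncrossing : ∀ i j k l → S i j → S k l → ¬ Cross i j k l
    noncrossing = proj₁ (proj₂ T)

    b≢a : b ≢ a
    b≢a = proj₁ (proj₁ ac×bd)
    b≢c : b ≢ c
    b≢c = proj₁ (proj₂ (proj₁ ac×bd))
    d≢a : d ≢ a
    d≢a = proj₁ (proj₂ (proj₂ (proj₁ ac×bd)))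
    d≢c : d ≢ c
    d≢c = proj₂ (proj₂ (proj₂ (proj₁ ac×bd)))

    old-¬cross-new : ∀ {k l} → S k l → ¬ SamePair a c k l → ¬ Cross b d k l
    old-¬cross-new {k} {l} Skl ¬ac bd×kl = [ noncrossing a c k l Sac Skl , [ side-¬cross T ab Skl ,
      [ side-¬cross T bc Skl , [ side-¬cross T cd Skl , [ side-¬cross T da Skl , ¬ac ] ] ] ] ]
      (cross-quadrilateral ac×bd bd×kl)

    flipped-noncrossing : ∀ i j k l → S' i j → S' k l → ¬ Cross i j k l
    flipped-noncrossing i j k l (inj₁ p) (inj₁ q) = samePair⇒¬cross (samePair-trans (samePair-sym p) q)
    flipped-noncrossing i j k l (inj₁ p) (inj₂ (Skl , ¬ac)) = old-¬cross-new Skl ¬ac ∘ cross-samePairˡ (samePair-sym p)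
    flipped-noncrossing i j k l (inj₂ (Sij , ¬ac)) (inj₁ q) =
      old-¬cross-new Sij ¬ac ∘ cross-samePairˡ (samePair-sym q) ∘ cross-sym
    flipped-noncrossing i j k l (inj₂ (Sij , _)) (inj₂ (Skl , _)) = noncrossing i j k l Sij Skl

    Crossed : Vert → Vert → Set
    Crossed k l = ∃[ i ] ∃[ j ] (S' i j × Cross i j k l)

    crossed-by-side : ∀ {p q k l} → Side S p q → ¬ SamePair a c p q → Cross p q k l → Crossed k l
    crossed-by-side (inj₁ e) _ pq×kl = contradiction pq×kl (edge-¬cross e)
    crossed-by-side {p} {q} (inj₂ Spq) ¬ac pq×kl = p , q , inj₂ (Spq , ¬ac) , pq×kl

    -- A diagonal crossing the old diagonal {a, c} crosses the new one or a side of the quadrilateral.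
    crossed-via-ac : ∀ {k l} → ¬ S' k l → Cross a c k l → Crossed k l
    crossed-via-ac {k} {l} ¬S'kl ac×kl = by-cases (cross-quadrilateral (cross-swapʳ (cross-sym ac×bd)) (cross-swapˡ ac×kl))
      where
      by-cases : Cross b d k l ⊎ Cross b c k l ⊎ Cross c d k l ⊎ Cross d a k l ⊎ Cross a b k l ⊎ SamePair b d k l → Crossed k l
      by-cases (inj₁ bd×kl) = b , d , inj₁ samePair-refl , bd×kl
      by-cases (inj₂ (inj₁ bc×kl)) = crossed-by-side bc (¬samePair (inj₁ (b≢a ∘ sym)) (inj₂ (b≢c ∘ sym))) bc×kl
      by-cases (inj₂ (inj₂ (inj₁ cd×kl))) = crossed-by-side cd (¬samePair (inj₂ (d≢c ∘ sym)) (inj₁ (d≢a ∘ sym))) cd×kl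
      by-cases (inj₂ (inj₂ (inj₂ (inj₁ da×kl)))) = crossed-by-side da (¬samePair (inj₁ (d≢a ∘ sym)) (inj₂ (d≢c ∘ sym))) da×kl
      by-cases (inj₂ (inj₂ (inj₂ (inj₂ (inj₁ ab×kl))))) = crossed-by-side ab (¬samePair (inj₂ (b≢c ∘ sym)) (inj₁ (b≢a ∘ sym))) ab×kl
      by-cases (inj₂ (inj₂ (inj₂ (inj₂ (inj₂ bd≡kl))))) = contradiction (inj₁ bd≡kl) ¬S'kl

    flipped-maximal : ∀ k l → IsDiag k l → ¬ S' k l → Crossed k l
    flipped-maximal k l kl-diag ¬S'kl with samePair? a c k l
    ... | yes ac≡kl = b , d , inj₁ samePair-refl , cross-samePairʳ ac≡kl (cross-sym ac×bd)
    ... | no ¬ac with diagonals k l kl-diag (λ Skl → ¬S'kl (inj₂ (Skl , ¬ac)))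
    ...   | i , j , Sij , ij×kl with samePair? a c i j
    ...     | yes ac≡ij = crossed-via-ac ¬S'kl (cross-samePairˡ (samePair-sym ac≡ij) ij×kl)
    ...     | no ¬ac' = i , j , inj₂ (Sij , ¬ac') , ij×kl

    flipped-isTriangulation : IsTriangulation S'
    flipped-isTriangulation =
      (λ { i j (inj₁ bd≡ij) → isDiag-samePair bd≡ij bd-diag ; i j (inj₂ (Sij , _)) → proj₁ T i j Sij }) ,
      flipped-noncrossing , flipped-maximal

  none? : (x : Label) → Dec (x ≡ none)
  none? none = yes refl
  none? central = no λ ()
  none? (col _) = no λ ()

  support? : ∀ L i j → Dec (Support L i j)
  support? L i j = ¬? (none? (L i j))

  ¬support⇒none : ∀ {L : Labeling} {i j} → ¬ Support L i j → L i j ≡ none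
  ¬support⇒none {L} {i} {j} = decidable-stable (none? (L i j))

  col≢none : ∀ {k} → col k ≢ none
  col≢none ()

  col⇒support : ∀ {L : Labeling} {p q k} → L p q ≡ col k → Support L p q
  col⇒support e = col≢none ∘ trans (sym e)

  central⇒support : ∀ {L : Labeling} {p q} → L p q ≡ central → Support L p q
  central⇒support e = (λ ()) ∘ trans (sym e)

  sameSymPair? : ∀ i j k l → Dec (SameSymPair i j k l)
  sameSymPair? i j k l = samePair? i j k l ⊎-dec samePair? (σ i) (σ j) k l

  samePair-σ : ∀ {x y i j} → SamePair x y i j → SamePair (σ x) (σ y) (σ i) (σ j)
  samePair-σ (inj₁ (refl , refl)) = inj₁ (refl , refl)
  samePair-σ (inj₂ (refl , refl)) = inj₂ (refl , refl)

  samePair-σ⁻ : ∀ {x y i j} → SamePair (σ x) (σ y) i j → SamePair x y (σ i) (σ j)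
  samePair-σ⁻ {x} {y} p = subst₂ (λ u v → SamePair u v _ _) (σ-involutive x) (σ-involutive y) (samePair-σ p)

  sameSymPair-σ : ∀ {x y i j} → SameSymPair x y i j → SameSymPair x y (σ i) (σ j)
  sameSymPair-σ (inj₁ p) = inj₂ (samePair-σ p)
  sameSymPair-σ (inj₂ p) = inj₁ (samePair-σ⁻ p)

  sameSymPair-σ⁻ : ∀ {x y i j} → SameSymPair x y (σ i) (σ j) → SameSymPair x y i j
  sameSymPair-σ⁻ {x} {y} {i} {j} p = subst₂ (SameSymPair x y) (σ-involutive i) (σ-involutive j) (sameSymPair-σ p)

  sameSymPair-swap : ∀ {x y i j} → SameSymPair x y i j → SameSymPair x y j i
  sameSymPair-swap (inj₁ p) = inj₁ (samePair-sym (samePair-swap (samePair-sym p)))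
  sameSymPair-swap (inj₂ p) = inj₂ (samePair-sym (samePair-swap (samePair-sym p)))

  sameSymPair-refl : ∀ {x y} → SameSymPair x y x y
  sameSymPair-refl = inj₁ samePair-refl

  sameSymPair-trans : ∀ {x y i j k l} → SameSymPair x y i j → SameSymPair x y k l → SameSymPair i j k l
  sameSymPair-trans (inj₁ p) (inj₁ q) = inj₁ (samePair-trans (samePair-sym p) q)
  sameSymPair-trans (inj₁ p) (inj₂ q) = inj₂ (samePair-trans (samePair-σ (samePair-sym p)) q)
  sameSymPair-trans (inj₂ p) (inj₁ q) = inj₂ (samePair-trans (samePair-sym (samePair-σ⁻ p)) q)
  sameSymPair-trans (inj₂ p) (inj₂ q) = inj₁ (samePair-trans (samePair-sym p) q)

  sameSymPair-sym : ∀ {x y i j} → SameSymPair x y i j → SameSymPair i j x y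
  sameSymPair-sym p = sameSymPair-trans p sameSymPair-refl

  samePair-antipodal : ∀ {b d i} → SamePair b d i (σ i) → d ≡ σ b
  samePair-antipodal (inj₁ (refl , refl)) = refl
  samePair-antipodal {i = i} (inj₂ (refl , refl)) = sym (σ-involutive i)

  sameSymPair-antipodal : ∀ {b d i} → SameSymPair b d i (σ i) → d ≡ σ b
  sameSymPair-antipodal (inj₁ p) = samePair-antipodal p
  sameSymPair-antipodal (inj₂ p) = σ-injective (samePair-antipodal p)

  central-sameSymPair⇒samePair : ∀ {x i j} → SameSymPair x (σ x) i j → SamePair x (σ x) i j
  central-sameSymPair⇒samePair (inj₁ p) = p
  central-sameSymPair⇒samePair {x} (inj₂ p) = samePair-swap (subst (λ z → SamePair (σ x) z _ _) (σ-involutive x) p)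

  central-samePair⇒antipodal : ∀ {x i j} → SamePair x (σ x) i j → j ≡ σ i
  central-samePair⇒antipodal (inj₁ (refl , refl)) = refl
  central-samePair⇒antipodal {x} (inj₂ (refl , refl)) = sym (σ-involutive x)

  edge-σ : ∀ {p q} → Edge p q → Edge (σ p) (σ q)
  edge-σ {p} {q} (inj₁ e) = inj₁ (trans (cong σ e) (σ-nextV p))
  edge-σ {p} {q} (inj₂ e) = inj₂ (trans (cong σ e) (σ-nextV q))

  isDiag-σ : ∀ {i j} → IsDiag i j → IsDiag (σ i) (σ j)
  isDiag-σ {i} {j} (i≢j , j≢i+1 , i≢j+1) =
    i≢j ∘ σ-injective , j≢i+1 ∘ σ-injective ∘ (λ e → trans e (sym (σ-nextV i))) ,
    i≢j+1 ∘ σ-injective ∘ (λ e → trans e (sym (σ-nextV j)))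

  isTriangulation-resp : ∀ {S S' : Vert → Vert → Set} → (∀ i j → S i j ⇔ S' i j) → IsTriangulation S → IsTriangulation S'
  isTriangulation-resp S⇔S' (diagonal , noncrossing , maximal) =
    (λ i j → diagonal i j ∘ from i j) ,
    (λ i j k l s s' → noncrossing i j k l (from i j s) (from k l s')) ,
    λ k l kl-diag ¬S'kl → case maximal k l kl-diag (¬S'kl ∘ to k l) of λ { (i , j , Sij , ij×kl) → i , j , to i j Sij , ij×kl }
    where
    to = λ i j → Equivalence.to (S⇔S' i j)
    from = λ i j → Equivalence.from (S⇔S' i j)

  module CST {L : Labeling} (v : IsColoredCST L) where
    symmetric : ∀ i j → L i j ≡ L j i
    symmetric = proj₁ v
    triangulation : IsTriangulation (Support L)
    triangulation = proj₁ (proj₂ v)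
    σ-invariant : ∀ i j → L (σ i) (σ j) ≡ L i j
    σ-invariant = proj₁ (proj₂ (proj₂ v))
    central⇒antipodal : ∀ i j → L i j ≡ central → j ≡ σ i
    central⇒antipodal = proj₁ (proj₂ (proj₂ (proj₂ v)))
    antipodal⇒central : ∀ i j → Support L i j → j ≡ σ i → L i j ≡ central
    antipodal⇒central = proj₁ (proj₂ (proj₂ (proj₂ (proj₂ v))))
    sameColor⇒sameSymPair : ∀ i j k l (c : Fin n) → L i j ≡ col c → L k l ≡ col c → SameSymPair i j k l
    sameColor⇒sameSymPair = proj₂ (proj₂ (proj₂ (proj₂ (proj₂ v))))
    support⇒isDiag : ∀ i j → Support L i j → IsDiag i j
    support⇒isDiag = proj₁ triangulation
    noncrossing : ∀ i j k l → Support L i j → Support L k l → ¬ Cross i j k l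
    noncrossing = proj₁ (proj₂ triangulation)
    maximal : ∀ k l → IsDiag k l → ¬ Support L k l → ∃[ i ] ∃[ j ] (Support L i j × Cross i j k l)
    maximal = proj₂ (proj₂ triangulation)
    support-σ : ∀ {i j} → Support L i j → Support L (σ i) (σ j)
    support-σ {i} {j} s = s ∘ trans (sym (σ-invariant i j))
    support-sym : ∀ {i j} → Support L i j → Support L j i
    support-sym {i} {j} s = s ∘ trans (symmetric i j)
    label-sameSymPair : ∀ {i j k l} → SameSymPair i j k l → L i j ≡ L k l
    label-sameSymPair (inj₁ (inj₁ (refl , refl))) = refl
    label-sameSymPair (inj₁ (inj₂ (refl , refl))) = symmetric _ _
    label-sameSymPair {i} {j} (inj₂ (inj₁ (refl , refl))) = sym (σ-invariant i j)
    label-sameSymPair {i} {j} (inj₂ (inj₂ (refl , refl))) = trans (sym (σ-invariant i j)) (symmetric _ _)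
    support-sameSymPair : ∀ {i j k l} → SameSymPair i j k l → Support L i j → Support L k l
    support-sameSymPair p s = s ∘ trans (label-sameSymPair p)
    col⇒¬antipodal : ∀ {i j k} → L i j ≡ col k → j ≢ σ i
    col⇒¬antipodal {i} {j} e j≡σi = case trans (sym e) (antipodal⇒central i j (col⇒support {L} e) j≡σi) of λ ()
    support-col : ∀ {i j} → Support L i j → j ≢ σ i → ∃[ k ] L i j ≡ col k
    support-col {i} {j} s j≢σi with L i j in eq
    ... | none = contradiction refl s
    ... | central = contradiction (central⇒antipodal i j eq) j≢σi
    ... | col k = k , refl

  select : ∀ {P Q : Set} → Dec P → Dec Q → Label → Label → Label
  select (yes _) _ new old = new
  select (no _) (yes _) new old = none
  select (no _) (no _) new old = old

  select-cong : ∀ {P Q P' Q' : Set} (p : Dec P) (q : Dec Q) (p' : Dec P') (q' : Dec Q') {new old old'} →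
                P ⇔ P' → Q ⇔ Q' → old ≡ old' → select p q new old ≡ select p' q' new old'
  select-cong (yes _) _ (yes _) _ _ _ _ = refl
  select-cong (yes p) _ (no ¬p') _ P⇔P' _ _ = contradiction (Equivalence.to P⇔P' p) ¬p'
  select-cong (no ¬p) _ (yes p') _ P⇔P' _ _ = contradiction (Equivalence.from P⇔P' p') ¬p
  select-cong (no _) (yes _) (no _) (yes _) _ _ _ = refl
  select-cong (no _) (yes q) (no _) (no ¬q') _ Q⇔Q' _ = contradiction (Equivalence.to Q⇔Q' q) ¬q'
  select-cong (no _) (no ¬q) (no _) (yes q') _ Q⇔Q' _ = contradiction (Equivalence.from Q⇔Q' q') ¬q
  select-cong (no _) (no _) (no _) (no _) _ _ e = e

  -- The labeling after the centrally symmetric pair of {a, c} is replaced by that of {b, d} with label x.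
  relabel : Labeling → Vert → Vert → Vert → Vert → Label → Labeling
  relabel L a c b d x i j = select (sameSymPair? b d i j) (sameSymPair? a c i j) x (L i j)

  select-new : ∀ {P Q : Set} (p : Dec P) (q : Dec Q) {new old} → P → select p q new old ≡ new
  select-new (yes _) _ _ = refl
  select-new (no ¬p) _ p = contradiction p ¬p

  select-none : ∀ {P Q : Set} (p : Dec P) (q : Dec Q) {new old} → ¬ P → Q → select p q new old ≡ none
  select-none (yes p) _ ¬p _ = contradiction p ¬p
  select-none (no _) (yes _) _ _ = refl
  select-none (no _) (no ¬q) _ q = contradiction q ¬q

  select-old : ∀ {P Q : Set} (p : Dec P) (q : Dec Q) {new old} → ¬ P → ¬ Q → select p q new old ≡ old
  select-old (yes p) _ ¬p _ = contradiction p ¬p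
  select-old (no _) (yes q) _ ¬q = contradiction q ¬q
  select-old (no _) (no _) _ _ = refl

  relabel-new : ∀ {L a c b d x i j} → SameSymPair b d i j → relabel L a c b d x i j ≡ x
  relabel-new {a = a} {c} {b} {d} {i = i} {j} = select-new (sameSymPair? b d i j) (sameSymPair? a c i j)

  relabel-old : ∀ {L a c b d x i j} → ¬ SameSymPair b d i j → SameSymPair a c i j → relabel L a c b d x i j ≡ none
  relabel-old {a = a} {c} {b} {d} {i = i} {j} = select-none (sameSymPair? b d i j) (sameSymPair? a c i j)

  relabel-other : ∀ {L a c b d x i j} → ¬ SameSymPair b d i j → ¬ SameSymPair a c i j → relabel L a c b d x i j ≡ L i j
  relabel-other {a = a} {c} {b} {d} {i = i} {j} = select-old (sameSymPair? b d i j) (sameSymPair? a c i j)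

  data RelabelView (L : Labeling) (a c b d : Vert) (x : Label) (i j : Vert) : Set where
    new : SameSymPair b d i j → relabel L a c b d x i j ≡ x → RelabelView L a c b d x i j
    old : ¬ SameSymPair b d i j → SameSymPair a c i j → relabel L a c b d x i j ≡ none → RelabelView L a c b d x i j
    other : ¬ SameSymPair b d i j → ¬ SameSymPair a c i j → relabel L a c b d x i j ≡ L i j → RelabelView L a c b d x i j

  relabel-view : ∀ L a c b d x i j → RelabelView L a c b d x i j
  relabel-view L a c b d x i j with sameSymPair? b d i j | sameSymPair? a c i j
  ... | yes bd | _ = new bd (relabel-new {L} bd)
  ... | no ¬bd | yes ac = old ¬bd ac (relabel-old {L} ¬bd ac)
  ... | no ¬bd | no ¬ac = other ¬bd ¬ac (relabel-other {L} ¬bd ¬ac)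

  relabel-sym : ∀ L a c b d x → (∀ i j → L i j ≡ L j i) → ∀ i j → relabel L a c b d x i j ≡ relabel L a c b d x j i
  relabel-sym L a c b d x L-sym i j =
    select-cong (sameSymPair? b d i j) (sameSymPair? a c i j) (sameSymPair? b d j i) (sameSymPair? a c j i)
      (mk⇔ sameSymPair-swap sameSymPair-swap) (mk⇔ sameSymPair-swap sameSymPair-swap) (L-sym i j)

  relabel-σ : ∀ L a c b d x → (∀ i j → L (σ i) (σ j) ≡ L i j) → ∀ i j → relabel L a c b d x (σ i) (σ j) ≡ relabel L a c b d x i j
  relabel-σ L a c b d x L-σ i j =
    select-cong (sameSymPair? b d (σ i) (σ j)) (sameSymPair? a c (σ i) (σ j)) (sameSymPair? b d i j) (sameSymPair? a c i j)
      (mk⇔ sameSymPair-σ⁻ sameSymPair-σ) (mk⇔ sameSymPair-σ⁻ sameSymPair-σ) (L-σ i j)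

  module PairFlipStep {L : Labeling} (v : IsColoredCST L) {a c b d : Vert} {k : Fin n}
    (ac-col : L a c ≡ col k) (ac×bd : Cross a c b d) (bd-diag : IsDiag b d) (d≢σb : d ≢ σ b)
    (ab : Side (Support L) a b) (bc : Side (Support L) b c) (cd : Side (Support L) c d) (da : Side (Support L) d a) where
    open CST v

    L' : Labeling
    L' = relabel L a c b d (col k)

    L'-new : ∀ {i j} → SameSymPair b d i j → L' i j ≡ col k
    L'-new = relabel-new {L} {a} {c} {b} {d} {col k}
    L'-old : ∀ {i j} → ¬ SameSymPair b d i j → SameSymPair a c i j → L' i j ≡ none
    L'-old = relabel-old {L} {a} {c} {b} {d} {col k}
    L'-other : ∀ {i j} → ¬ SameSymPair b d i j → ¬ SameSymPair a c i j → L' i j ≡ L i j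
    L'-other = relabel-other {L} {a} {c} {b} {d} {col k}

    Sac : Support L a c
    Sac = col⇒support {L} ac-col

    ¬Sbd : ¬ Support L b d
    ¬Sbd Sbd = noncrossing a c b d Sac Sbd ac×bd

    a≢σa : a ≢ σ a
    a≢σa = σ-no-fixpoint a ∘ sym
    c≢σc : c ≢ σ c
    c≢σc = σ-no-fixpoint c ∘ sym
    c≢σa : c ≢ σ a
    c≢σa = col⇒¬antipodal ac-col
    a≢σc : a ≢ σ c
    a≢σc a≡σc = c≢σa (trans (sym (σ-involutive c)) (cong σ (sym a≡σc)))

    -- The flip of {a, c} is followed by the flip of its mirror image {σ a, σ c}.
    module First = Flip triangulation Sac ac×bd bd-diag ab bc cd da

    side-σ : ∀ {p q} → Side (Support L) p q → ¬ SamePair a c (σ p) (σ q) → Side First.S' (σ p) (σ q)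
    side-σ (inj₁ e) _ = inj₁ (edge-σ e)
    side-σ (inj₂ s) ¬ac = inj₂ (inj₂ (support-σ s , ¬ac))

    module Second = Flip First.flipped-isTriangulation
      (inj₂ (support-σ Sac , ¬samePair (inj₁ a≢σa) (inj₁ a≢σc))) (σ-cross ac×bd) (isDiag-σ bd-diag)
      (side-σ ab (¬samePair (inj₁ a≢σa) (inj₂ c≢σa))) (side-σ bc (¬samePair (inj₂ c≢σc) (inj₁ a≢σc)))
      (side-σ cd (¬samePair (inj₁ a≢σc) (inj₂ c≢σc))) (side-σ da (¬samePair (inj₂ c≢σa) (inj₁ a≢σa)))

    flipped⇔support : ∀ i j → Second.S' i j ⇔ Support L' i j
    flipped⇔support i j = mk⇔ (to view) (from view)
      where
      view = relabel-view L a c b d (col k) i j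
      to : RelabelView L a c b d (col k) i j → Second.S' i j → Support L' i j
      to _ (inj₁ σbd) = col⇒support {L'} (L'-new (inj₂ σbd))
      to _ (inj₂ (inj₁ bd , _)) = col⇒support {L'} (L'-new (inj₁ bd))
      to (new _ e) (inj₂ (inj₂ _ , _)) = col⇒support {L'} e
      to (old _ (inj₁ ac) _) (inj₂ (inj₂ (_ , ¬ac) , _)) = contradiction ac ¬ac
      to (old _ (inj₂ σac) _) (inj₂ (inj₂ _ , ¬σac)) = contradiction σac ¬σac
      to (other _ _ e) (inj₂ (inj₂ (Sij , _) , _)) = Sij ∘ trans (sym e)
      from : RelabelView L a c b d (col k) i j → Support L' i j → Second.S' i j
      from (new (inj₁ bd) _) _ = inj₂ (inj₁ bd , λ σac → ¬Sbd (support-sameSymPair (inj₂ (samePair-trans σac (samePair-sym bd))) Sac))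
      from (new (inj₂ σbd) _) _ = inj₁ σbd
      from (old _ _ e) S'ij = contradiction e S'ij
      from (other _ ¬ac e) S'ij = inj₂ (inj₂ (S'ij ∘ trans e , ¬ac ∘ inj₁) , ¬ac ∘ inj₂)

    central⇒antipodal' : ∀ i j → L' i j ≡ central → j ≡ σ i
    central⇒antipodal' i j e = by-view (relabel-view L a c b d (col k) i j)
      where
      by-view : RelabelView L a c b d (col k) i j → j ≡ σ i
      by-view (new _ e') = case trans (sym e') e of λ ()
      by-view (old _ _ e') = case trans (sym e') e of λ ()
      by-view (other _ _ e') = central⇒antipodal i j (trans (sym e') e)

    antipodal⇒central' : ∀ i j → Support L' i j → j ≡ σ i → L' i j ≡ central
    antipodal⇒central' i .(σ i) S'ij refl = by-view (relabel-view L a c b d (col k) i (σ i))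
      where
      by-view : RelabelView L a c b d (col k) i (σ i) → L' i (σ i) ≡ central
      by-view (new bd _) = contradiction (sameSymPair-antipodal bd) d≢σb
      by-view (old _ _ e) = contradiction e S'ij
      by-view (other _ _ e) = trans e (antipodal⇒central i (σ i) (S'ij ∘ trans e) refl)

    sameColor⇒sameSymPair' : ∀ i j x y (c' : Fin n) → L' i j ≡ col c' → L' x y ≡ col c' → SameSymPair i j x y
    sameColor⇒sameSymPair' i j x y c' ij-col xy-col =
      by-view (relabel-view L a c b d (col k) i j) (relabel-view L a c b d (col k) x y)
      where
      by-view : RelabelView L a c b d (col k) i j → RelabelView L a c b d (col k) x y → SameSymPair i j x y
      by-view (new bd _) (new bd' _) = sameSymPair-trans bd bd'
      by-view (new _ e) (other _ ¬ac e') =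
        contradiction (sameColor⇒sameSymPair a c x y k ac-col (trans (sym e') (trans xy-col (trans (sym ij-col) e)))) ¬ac
      by-view (other _ ¬ac e') (new _ e) =
        contradiction (sameColor⇒sameSymPair a c i j k ac-col (trans (sym e') (trans ij-col (trans (sym xy-col) e)))) ¬ac
      by-view (other _ _ e) (other _ _ e') = sameColor⇒sameSymPair i j x y c' (trans (sym e) ij-col) (trans (sym e') xy-col)
      by-view (old _ _ e) _ = case trans (sym e) ij-col of λ ()
      by-view _ (old _ _ e) = case trans (sym e) xy-col of λ ()

    T' : ColoredCST
    T' = record
      { lab = L'
      ; valid = relabel-sym L a c b d (col k) symmetric ,
                isTriangulation-resp flipped⇔support Second.flipped-isTriangulation ,
                relabel-σ L a c b d (col k) σ-invariant ,
                central⇒antipodal' , antipodal⇒central' , sameColor⇒sameSymPair'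
      }

    ¬ac≡bd : ¬ SameSymPair a c b d
    ¬ac≡bd (inj₁ ac≡bd) = ¬samePair (inj₁ (proj₁ (proj₁ ac×bd) ∘ sym)) (inj₂ (proj₁ (proj₂ (proj₁ ac×bd)) ∘ sym)) ac≡bd
    ¬ac≡bd (inj₂ σac≡bd) = ¬Sbd (support-sameSymPair (inj₂ σac≡bd) Sac)

    flip : PairFlip L L'
    flip = k , a , c , b , d , ¬ac≡bd , ac-col ,
      L'-old (¬ac≡bd ∘ sameSymPair-sym) sameSymPair-refl ,
      ¬support⇒none {L} ¬Sbd , L'-new sameSymPair-refl ,
      λ i j ¬changed → sym (L'-other (¬changed ∘ inj₂) (¬changed ∘ inj₁))

  module CentralFlipStep {L : Labeling} (v : IsColoredCST L) {a b : Vert}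
    (aσa-central : L a (σ a) ≡ central) (aσa×bσb : Cross a (σ a) b (σ b)) (bσb-diag : IsDiag b (σ b))
    (ab : Side (Support L) a b) (bσa : Side (Support L) b (σ a)) (σaσb : Side (Support L) (σ a) (σ b))
    (σba : Side (Support L) (σ b) a) where
    open CST v

    L' : Labeling
    L' = relabel L a (σ a) b (σ b) central

    L'-new : ∀ {i j} → SameSymPair b (σ b) i j → L' i j ≡ central
    L'-new = relabel-new {L} {a} {σ a} {b} {σ b} {central}
    L'-old : ∀ {i j} → ¬ SameSymPair b (σ b) i j → SameSymPair a (σ a) i j → L' i j ≡ none
    L'-old = relabel-old {L} {a} {σ a} {b} {σ b} {central}
    L'-other : ∀ {i j} → ¬ SameSymPair b (σ b) i j → ¬ SameSymPair a (σ a) i j → L' i j ≡ L i j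
    L'-other = relabel-other {L} {a} {σ a} {b} {σ b} {central}

    Saσa : Support L a (σ a)
    Saσa = central⇒support {L} aσa-central

    ¬Sbσb : ¬ Support L b (σ b)
    ¬Sbσb Sbσb = noncrossing a (σ a) b (σ b) Saσa Sbσb aσa×bσb

    module Only = Flip triangulation Saσa aσa×bσb bσb-diag ab bσa σaσb σba

    flipped⇔support : ∀ i j → Only.S' i j ⇔ Support L' i j
    flipped⇔support i j = mk⇔ (to view) (from view)
      where
      view = relabel-view L a (σ a) b (σ b) central i j
      to : RelabelView L a (σ a) b (σ b) central i j → Only.S' i j → Support L' i j
      to _ (inj₁ bσb) = central⇒support {L'} (L'-new (inj₁ bσb))
      to (new _ e) (inj₂ _) = central⇒support {L'} e
      to (old _ aσa _) (inj₂ (_ , ¬aσa)) = contradiction (central-sameSymPair⇒samePair aσa) ¬aσa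
      to (other _ _ e) (inj₂ (Sij , _)) = Sij ∘ trans (sym e)
      from : RelabelView L a (σ a) b (σ b) central i j → Support L' i j → Only.S' i j
      from (new bσb _) _ = inj₁ (central-sameSymPair⇒samePair bσb)
      from (old _ _ e) S'ij = contradiction e S'ij
      from (other _ ¬aσa e) S'ij = inj₂ (S'ij ∘ trans e , ¬aσa ∘ inj₁)

    central⇒antipodal' : ∀ i j → L' i j ≡ central → j ≡ σ i
    central⇒antipodal' i j e = by-view (relabel-view L a (σ a) b (σ b) central i j)
      where
      by-view : RelabelView L a (σ a) b (σ b) central i j → j ≡ σ i
      by-view (new bσb _) = central-samePair⇒antipodal (central-sameSymPair⇒samePair bσb)
      by-view (old _ _ e') = case trans (sym e') e of λ ()
      by-view (other _ _ e') = central⇒antipodal i j (trans (sym e') e)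

    antipodal⇒central' : ∀ i j → Support L' i j → j ≡ σ i → L' i j ≡ central
    antipodal⇒central' i .(σ i) S'ij refl = by-view (relabel-view L a (σ a) b (σ b) central i (σ i))
      where
      by-view : RelabelView L a (σ a) b (σ b) central i (σ i) → L' i (σ i) ≡ central
      by-view (new _ e) = e
      by-view (old _ _ e) = contradiction e S'ij
      by-view (other _ _ e) = trans e (antipodal⇒central i (σ i) (S'ij ∘ trans e) refl)

    sameColor⇒sameSymPair' : ∀ i j x y (c : Fin n) → L' i j ≡ col c → L' x y ≡ col c → SameSymPair i j x y
    sameColor⇒sameSymPair' i j x y c ij-col xy-col =
      by-view (relabel-view L a (σ a) b (σ b) central i j) (relabel-view L a (σ a) b (σ b) central x y)
      where
      by-view : RelabelView L a (σ a) b (σ b) central i j → RelabelView L a (σ a) b (σ b) central x y → SameSymPair i j x y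
      by-view (other _ _ e) (other _ _ e') = sameColor⇒sameSymPair i j x y c (trans (sym e) ij-col) (trans (sym e') xy-col)
      by-view (new _ e) _ = case trans (sym e) ij-col of λ ()
      by-view (old _ _ e) _ = case trans (sym e) ij-col of λ ()
      by-view _ (new _ e) = case trans (sym e) xy-col of λ ()
      by-view _ (old _ _ e) = case trans (sym e) xy-col of λ ()

    T' : ColoredCST
    T' = record
      { lab = L'
      ; valid = relabel-sym L a (σ a) b (σ b) central symmetric ,
                isTriangulation-resp flipped⇔support Only.flipped-isTriangulation ,
                relabel-σ L a (σ a) b (σ b) central σ-invariant ,
                central⇒antipodal' , antipodal⇒central' , sameColor⇒sameSymPair'
      }

    ¬aσa≡bσb : ¬ SamePair a (σ a) b (σ b)
    ¬aσa≡bσb = ¬samePair (inj₁ (proj₁ (proj₁ aσa×bσb) ∘ sym)) (inj₂ (proj₁ (proj₂ (proj₁ aσa×bσb)) ∘ sym))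

    flip : CentralFlip L L'
    flip = a , b , ¬aσa≡bσb , aσa-central ,
      L'-old (¬aσa≡bσb ∘ samePair-sym ∘ central-sameSymPair⇒samePair) sameSymPair-refl ,
      ¬support⇒none {L} ¬Sbσb , L'-new sameSymPair-refl ,
      λ i j ¬changed → sym (L'-other (¬changed ∘ inj₂ ∘ central-sameSymPair⇒samePair)
                                          (¬changed ∘ inj₁ ∘ central-sameSymPair⇒samePair))

  flip-sym : ∀ {T U} → Flip T U → Flip U T
  flip-sym (inj₁ (a , b , ¬same , l₁ , l₂ , l₃ , l₄ , agree)) =
    inj₁ (b , a , ¬same ∘ samePair-sym , l₄ , l₃ , l₂ , l₁ , λ i j ¬changed → sym (agree i j (¬changed ∘ Data.Sum.swap)))
  flip-sym (inj₂ (k , a , c , b , d , ¬same , l₁ , l₂ , l₃ , l₄ , agree)) =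
    inj₂ (k , b , d , a , c , ¬same ∘ sameSymPair-sym , l₄ , l₃ , l₂ , l₁ , λ i j ¬changed → sym (agree i j (¬changed ∘ Data.Sum.swap)))

  flip-respˡ : ∀ {T T' U} → SameCST T T' → Flip T' U → Flip T U
  flip-respˡ T≗T' (inj₁ (a , b , ¬same , l₁ , l₂ , l₃ , l₄ , agree)) =
    inj₁ (a , b , ¬same , trans (T≗T' _ _) l₁ , l₂ , trans (T≗T' _ _) l₃ , l₄ , λ i j ¬changed → trans (T≗T' i j) (agree i j ¬changed))
  flip-respˡ T≗T' (inj₂ (k , a , c , b , d , ¬same , l₁ , l₂ , l₃ , l₄ , agree)) =
    inj₂ (k , a , c , b , d , ¬same , trans (T≗T' _ _) l₁ , l₂ , trans (T≗T' _ _) l₃ , l₄ ,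
          λ i j ¬changed → trans (T≗T' i j) (agree i j ¬changed))

  reachable-respˡ : ∀ {T T' V} → SameCST T T' → Reachable T' V → Reachable T V
  reachable-respˡ T≗T' (here T'≗V) = here (λ i j → trans (T≗T' i j) (T'≗V i j))
  reachable-respˡ {T} {T'} T≗T' (step {U = U} f r) = step (flip-respˡ {T} {T'} {U} T≗T' f) r

  reachable-trans : ∀ {T U V} → Reachable T U → Reachable U V → Reachable T V
  reachable-trans (here T≗U) r = reachable-respˡ T≗U r
  reachable-trans (step f r) r' = step f (reachable-trans r r')

  reachable-refl : ∀ {T} → Reachable T T
  reachable-refl {T} = here {T} {T} (λ i j → refl)

  flip⇒reachable : ∀ {T U} → Flip T U → Reachable T U
  flip⇒reachable {T} {U} f = step f (reachable-refl {U})

  reachable-sym : ∀ {T U} → Reachable T U → Reachable U T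
  reachable-sym (here T≗U) = here (λ i j → sym (T≗U i j))
  reachable-sym (step {T} {U} f r) = reachable-trans (reachable-sym r) (flip⇒reachable (flip-sym {T} {U} f))

  edge? : ∀ p q → Dec (Edge p q)
  edge? p q = q Fin.≟ nextV p ⊎-dec p Fin.≟ nextV q

  side? : ∀ L p q → Dec (Side (Support L) p q)
  side? L p q = edge? p q ⊎-dec support? L p q

  edge-sym : ∀ {p q} → Edge p q → Edge q p
  edge-sym = Data.Sum.swap

  edge-values : ∀ {p q} → Edge p q → ν p < ν q → ν q ≡ suc (ν p) ⊎ (ν p ≡ 0 × suc (ν q) ≡ N)
  edge-values {p} {q} (inj₁ refl) p<q with ν p + 1 <? N
  ... | yes p+1<N = inj₁ (trans (ν-nextV-< p p+1<N) (+-comm (ν p) 1))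
  ... | no p+1≮N = contradiction (subst (ν p <_) (ν-nextV-last p (p+1≡N p p+1≮N)) p<q) λ ()
    where p+1≡N : ∀ p → ¬ ν p + 1 < N → ν p + 1 ≡ N
          p+1≡N p p+1≮N = ≤-antisym (subst (_≤ N) (+-comm 1 (ν p)) (ν<N p)) (≮⇒≥ p+1≮N)
  edge-values {p} {q} (inj₂ refl) p<q with ν q + 1 <? N
  ... | yes q+1<N = contradiction (subst (ν q <_) (sym (trans (ν-nextV-< q q+1<N) (+-comm (ν q) 1))) (n<1+n (ν q))) (<-asym p<q)
  ... | no q+1≮N = inj₂ (ν-nextV-last q q+1≡N , trans (+-comm 1 (ν q)) q+1≡N)
    where q+1≡N = ≤-antisym (subst (_≤ N) (+-comm 1 (ν q)) (ν<N q)) (≮⇒≥ q+1≮N)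

  ν<⇒≢ : ∀ {i j} → ν i < ν j → i ≢ j
  ν<⇒≢ i<j refl = <-irrefl refl i<j

  h≢1 : h ≢ 1
  h≢1 h≡1 = contradiction (subst (2 ≤_) h≡1 2≤h) λ { (s≤s ()) }

  module Triangulated {L : Labeling} (v : IsColoredCST L) where
    open CST v public

    S : Vert → Vert → Set
    S = Support L

    side-sym : ∀ {p q} → Side S p q → Side S q p
    side-sym (inj₁ e) = inj₁ (edge-sym e)
    side-sym (inj₂ s) = inj₂ (support-sym s)

    side-σ : ∀ {p q} → Side S p q → Side S (σ p) (σ q)
    side-σ (inj₁ e) = inj₁ (edge-σ e)
    side-σ (inj₂ s) = inj₂ (support-σ s)

    sides-¬cross : ∀ {p q x y} → Side S p q → Side S x y → ¬ Cross p q x y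
    sides-¬cross pq (inj₂ Sxy) = side-¬cross triangulation pq Sxy
    sides-¬cross pq (inj₁ e) = edge-¬cross e ∘ cross-sym

    triangle-closes : ∀ {c u w} → Side S c u → Side S c w → ν c < ν u → ν u < ν w →
                      (∀ t → ν u < ν t → ν t < ν w → ¬ Side S c t) → Side S u w
    triangle-closes {c} {u} {w} cu cw c<u u<w unseen = by-decision (side? L u w)
      where
      blocked : ∀ {s t} → S s t →
                Cross c u s t ⊎ Cross c w s t ⊎ (s ≡ c × ν u < ν t × ν t < ν w) ⊎ (t ≡ c × ν u < ν s × ν s < ν w) → ⊥
      blocked Sst (inj₁ cu×st) = side-¬cross triangulation cu Sst cu×st
      blocked Sst (inj₂ (inj₁ cw×st)) = side-¬cross triangulation cw Sst cw×st
      blocked {t = t} Sst (inj₂ (inj₂ (inj₁ (refl , u<t , t<w)))) = unseen t u<t t<w (inj₂ Sst)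
      blocked {s} Sst (inj₂ (inj₂ (inj₂ (refl , u<s , s<w)))) = unseen s u<s s<w (inj₂ (support-sym Sst))
      uncrossed : ¬ (∃[ s ] ∃[ t ] (S s t × Cross s t u w))
      uncrossed (s , t , Sst , st×uw) = blocked Sst (cross-triangle c<u u<w (cross-sym st×uw))
      by-decision : Dec (Side S u w) → Side S u w
      by-decision (yes uw) = uw
      by-decision (no ¬uw) =
        contradiction (maximal u w (ν<⇒≢ u<w , ¬uw ∘ inj₁ ∘ inj₁ , ¬uw ∘ inj₁ ∘ inj₂) (¬uw ∘ inj₂)) uncrossed

    triangle-apex : ∀ {u w} → Side S u w → suc (ν u) < ν w →
                    ∃[ x ] ν u < ν x × ν x < ν w × Side S u x × Side S x w
    triangle-apex {u} {w} uw 1+u<w = apex (greatestBelow (λ m → side? L u (vertex m)) u-sees-next 1+u<w)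
      where
      1+u<N : suc (ν u) < N
      1+u<N = <-trans 1+u<w (ν<N w)
      u-sees-next : Side S u (vertex (suc (ν u)))
      u-sees-next = inj₁ (inj₁ (ν-injective (trans (ν-vertex (suc (ν u)) 1+u<N)
                                 (sym (trans (ν-nextV-< u (subst (_< N) (+-comm 1 (ν u)) 1+u<N)) (+-comm (ν u) 1))))))
      apex : ∃[ m ] suc (ν u) ≤ m × m < ν w × Side S u (vertex m) × (∀ y → m < y → y < ν w → ¬ Side S u (vertex y)) →
             ∃[ x ] ν u < ν x × ν x < ν w × Side S u x × Side S x w
      apex (m , 1+u≤m , m<w , um , beyond) = vertex m , u<x , x<w , um ,
        triangle-closes um uw u<x x<w (λ t x<t t<w ut → beyond (ν t) (subst (_< ν t) νx x<t) t<w
                                                         (subst (Side S u) (sym (vertex-ν t (ν t) refl)) ut))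
        where
        νx : ν (vertex m) ≡ m
        νx = ν-vertex m (<-trans m<w (ν<N w))
        u<x : ν u < ν (vertex m)
        u<x = subst (ν u <_) (sym νx) 1+u≤m
        x<w : ν (vertex m) < ν w
        x<w = subst (_< ν w) (sym νx) m<w

    side-spanning-h : ∀ {i j} → Side S i j → ν i + h ≡ ν j → ∃[ c ] ν c < h × L c (σ c) ≡ central
    side-spanning-h {i} {j} ij i+h≡j = i , i<h , subst (λ z → L i z ≡ central) j≡σi (antipodal⇒central i j (side⇒support ij) j≡σi)
      where
      i<h : ν i < h
      i<h = +-cancelʳ-< h (ν i) h (subst (_< h + h) (sym i+h≡j) (subst (ν j <_) N≡h+h (ν<N j)))
      j≡σi : j ≡ σ i
      j≡σi = ν-injective (trans (sym i+h≡j) (sym (ν-σ-low i i<h)))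
      not-edge : ν j ≡ suc (ν i) ⊎ (ν i ≡ 0 × suc (ν j) ≡ N) → ⊥
      not-edge (inj₁ j≡1+i) = h≢1 (+-cancelˡ-≡ (ν i) h 1 (trans i+h≡j (trans j≡1+i (+-comm 1 (ν i)))))
      not-edge (inj₂ (i≡0 , 1+j≡N)) =
        h≢1 (sym (+-cancelʳ-≡ h 1 h (trans (cong suc (sym (trans (sym i+h≡j) (cong (_+ h) i≡0)))) (trans 1+j≡N N≡h+h))))
      side⇒support : Side S i j → S i j
      side⇒support (inj₂ Sij) = Sij
      side⇒support (inj₁ e) = ⊥-elim (not-edge (edge-values e (subst (ν i <_) i+h≡j (m<m+n (ν i) (≤-trans (s≤s z≤n) 2≤h)))))

    short-sides-cross : ∀ {i x j} → ν x < ν j → ν i + h < ν j → ν x < ν i + h → ν j < ν x + h → Cross x j (σ i) (σ x)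
    short-sides-cross {i} {x} {j} x<j i+h<j x<i+h j<x+h with ν x <? h
    ... | yes x<h = sorted⇒cross x<σi σi<j (subst (ν j <_) (sym (ν-σ-low x x<h)) j<x+h)
      where
      i<h = +-cancelʳ-< h (ν i) h (<-trans i+h<j (subst (ν j <_) N≡h+h (ν<N j)))
      x<σi = subst (ν x <_) (sym (ν-σ-low i i<h)) x<i+h
      σi<j = subst (_< ν j) (sym (ν-σ-low i i<h)) i+h<j
    ... | no x≮h = cross-swapʳ (cross-sym (sorted⇒cross (<-≤-trans (σ-high⇒low x (≮⇒≥ x≮h)) (≮⇒≥ x≮h)) x<σi σi<j))
      where
      i<h = +-cancelʳ-< h (ν i) h (<-trans i+h<j (subst (ν j <_) N≡h+h (ν<N j)))
      x<σi = subst (ν x <_) (sym (ν-σ-low i i<h)) x<i+h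
      σi<j = subst (_< ν j) (sym (ν-σ-low i i<h)) i+h<j

    -- Either {i, j} is central, or one side of its triangle still spans at least h: otherwise the third
    -- side {x, j} would cross the mirror image of {i, x}.  The fuel bounds ν j ∸ ν i.
    central-under : ∀ fuel {i j} → ν j < ν i + fuel → Side S i j → ν i + h ≤ ν j → ∃[ c ] ν c < h × L c (σ c) ≡ central
    central-under zero {i} {j} j<i+0 _ i+h≤j =
      contradiction (≤-trans (m≤m+n (ν i) h) i+h≤j) (<⇒≱ (subst (ν j <_) (+-identityʳ (ν i)) j<i+0))
    central-under (suc fuel) {i} {j} j<i+1+f ij i+h≤j = by-span (ν i + h ≟ ν j)
      where
      by-apex : ν i + h < ν j → ∃[ x ] ν i < ν x × ν x < ν j × Side S i x × Side S x j → ∃[ c ] ν c < h × L c (σ c) ≡ central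
      by-apex i+h<j (x , i<x , x<j , ix , xj) = by-halves (ν i + h ≤? ν x) (ν x + h ≤? ν j)
        where
        by-halves : Dec (ν i + h ≤ ν x) → Dec (ν x + h ≤ ν j) → ∃[ c ] ν c < h × L c (σ c) ≡ central
        by-halves (yes i+h≤x) _ =
          central-under fuel (<-≤-trans x<j (≤-pred (subst (suc (ν j) ≤_) (+-suc (ν i) fuel) j<i+1+f))) ix i+h≤x
        by-halves (no _) (yes x+h≤j) =
          central-under fuel (<-≤-trans j<i+1+f (≤-trans (≤-reflexive (+-suc (ν i) fuel)) (+-monoˡ-≤ fuel i<x))) xj x+h≤j
        by-halves (no i+h≰x) (no x+h≰j) =
          contradiction (short-sides-cross {i} x<j i+h<j (≰⇒> i+h≰x) (≰⇒> x+h≰j)) (sides-¬cross xj (side-σ ix))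
      by-span : Dec (ν i + h ≡ ν j) → ∃[ c ] ν c < h × L c (σ c) ≡ central
      by-span (yes i+h≡j) = side-spanning-h ij i+h≡j
      by-span (no i+h≢j) = by-apex (≤∧≢⇒< i+h≤j i+h≢j)
        (triangle-apex ij (≤-trans (≤-reflexive (+-comm 2 (ν i))) (≤-trans (+-monoʳ-≤ (ν i) 2≤h) i+h≤j)))

    central-diagonal : ∃[ c ] ν c < h × L c (σ c) ≡ central
    central-diagonal = central-under N last<0+N first-last h≤last
      where
      last : ℕ
      last = suc (suc (suc (2 * n)))
      ν-last : ν (vertex last) ≡ last
      ν-last = ν-vertex last (n<1+n last)
      ν-first : ν (vertex 0) ≡ 0
      ν-first = ν-vertex 0 (s≤s z≤n)
      last<0+N : ν (vertex last) < ν (vertex 0) + N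
      last<0+N = subst₂ _<_ (sym ν-last) (cong (_+ N) (sym ν-first)) (n<1+n last)
      first-last : Side S (vertex 0) (vertex last)
      first-last = inj₁ (inj₂ (ν-injective (trans ν-first (sym (ν-nextV-last (vertex last) (trans (cong (_+ 1) ν-last) (+-comm last 1)))))))
      h≤last : ν (vertex 0) + h ≤ ν (vertex last)
      h≤last = subst₂ _≤_ (cong (_+ h) (sym ν-first)) (sym ν-last)
                 (subst (_≤ last) (+-comm 2 n) (s≤s (s≤s (≤-trans (m≤m+n n (n + 0)) (n≤1+n _)))))

  -- The n diagonals from o into the half-polygon o, o + 1, …, σ o, together with the central
  -- diagonal {o, σ o}.
  module FanAt (o : Vert) (o<h : ν o < h) where
    C : ℕ
    C = ν o

    ν-σo : ν (σ o) ≡ C + h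
    ν-σo = ν-σ-low o o<h

    C+h<N : C + h < N
    C+h<N = subst (C + h <_) (sym N≡h+h) (+-monoˡ-< h o<h)

    C+1<N : C + 1 < N
    C+1<N = ≤-<-trans (+-monoʳ-≤ C (≤-trans (s≤s z≤n) 2≤h)) C+h<N

    σ-leaves-half : ∀ y → C < ν y → ν y < C + h → ν (σ y) < C ⊎ C + h < ν (σ y)
    σ-leaves-half y C<y y<C+h with ν y <? h
    ... | yes y<h = inj₂ (subst (C + h <_) (sym (ν-σ-low y y<h)) (+-monoˡ-< h C<y))
    ... | no y≮h = inj₁ (+-cancelʳ-< h (ν (σ y)) C (subst (_< C + h) (sym (ν-σ-high y (≮⇒≥ y≮h))) y<C+h))

    σ-half≢o : ∀ y → C < ν y → ν y < C + h → σ y ≢ o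
    σ-half≢o y C<y y<C+h σy≡o with σ-leaves-half y C<y y<C+h
    ... | inj₁ σy<C = <-irrefl (cong ν σy≡o) σy<C
    ... | inj₂ C+h<σy = <⇒≱ (subst (C + h <_) (cong ν σy≡o) C+h<σy) (m≤m+n C h)

    σ-half≢half : ∀ y z → C < ν y → ν y < C + h → C < ν z → ν z < C + h → σ y ≢ z
    σ-half≢half y z C<y y<C+h C<z z<C+h σy≡z with σ-leaves-half y C<y y<C+h
    ... | inj₁ σy<C = <-asym C<z (subst (_< C) (cong ν σy≡z) σy<C)
    ... | inj₂ C+h<σy = <-asym z<C+h (subst (C + h <_) (cong ν σy≡z) C+h<σy)

    fanVertex : ℕ → Vert
    fanVertex t = vertex (C + 2 + t)

    C+2+t<C+h : ∀ t → t < n → C + 2 + t < C + h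
    C+2+t<C+h t t<n = subst (_< C + h) (sym (+-assoc C 2 t)) (+-monoʳ-< C (subst (2 + t <_) (+-comm 2 n) (s≤s (s≤s t<n))))

    ν-fanVertex : ∀ t → t < n → ν (fanVertex t) ≡ C + 2 + t
    ν-fanVertex t t<n = ν-vertex _ (<-trans (C+2+t<C+h t t<n) C+h<N)

    fanVertex-in-half : ∀ t → t < n → C < ν (fanVertex t) × ν (fanVertex t) < C + h
    fanVertex-in-half t t<n =
      subst (C <_) (sym (ν-fanVertex t t<n)) (<-≤-trans (m<m+n C {2} (s≤s z≤n)) (m≤m+n (C + 2) t)) ,
      subst (_< C + h) (sym (ν-fanVertex t t<n)) (C+2+t<C+h t t<n)

    Fan : ColoredCST → Set
    Fan T = lab T o (σ o) ≡ central × (∀ t → t < n → Support (lab T) o (fanVertex t))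

    missing : ColoredCST → ℕ
    missing T = sum< n (λ t → indicator (¬? (support? (lab T) o (fanVertex t))))

    -- One pair flip adds the missing fan diagonal {o, X}: X is the apex beyond the side {U, W} of
    -- the triangle of o that contains the missing fan vertex.
    module Step (T : ColoredCST) (central-o : lab T o (σ o) ≡ central) (t₀ : ℕ) (t₀<n : t₀ < n)
                (miss : ¬ Support (lab T) o (fanVertex t₀)) where
      L = lab T
      open Triangulated (valid T)

      k : ℕ
      k = C + 2 + t₀

      Seen : ℕ → Set
      Seen m = Side S o (vertex m)

      sees-next : Seen (suc C)
      sees-next = inj₁ (inj₁ (ν-injective (trans (ν-vertex (suc C) (subst (_< N) (+-comm C 1) C+1<N))
                                          (trans (+-comm 1 C) (sym (ν-nextV-< o C+1<N))))))

      sees-σo : Seen (C + h)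
      sees-σo = inj₂ (subst (Support L o) (sym (vertex-ν (σ o) (C + h) ν-σo)) (central⇒support {L} central-o))

      1+C<k : suc C < k
      1+C<k = <-≤-trans (subst (suc C <_) (+-comm 2 C) (s≤s (n<1+n C))) (m≤m+n (C + 2) t₀)

      module Between (mu : ℕ) (1+C≤mu : suc C ≤ mu) (mu<k : mu < k) (sees-mu : Seen mu)
                     (unseen-above : ∀ y → mu < y → y < k → ¬ Seen y)
                     (mw : ℕ) (k<mw : k < mw) (mw≤C+h : mw ≤ C + h) (sees-mw : Seen mw)
                     (unseen-below : ∀ y → k < y → y < mw → ¬ Seen y) where
        U W : Vert
        U = vertex mu
        W = vertex mw
        ν-U : ν U ≡ mu
        ν-U = ν-vertex mu (<-trans mu<k (<-trans (C+2+t<C+h t₀ t₀<n) C+h<N))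
        ν-W : ν W ≡ mw
        ν-W = ν-vertex mw (≤-<-trans mw≤C+h C+h<N)
        C<U : C < ν U
        C<U = subst (C <_) (sym ν-U) 1+C≤mu
        U<W : ν U < ν W
        U<W = subst₂ _<_ (sym ν-U) (sym ν-W) (<-trans mu<k k<mw)
        U<C+h : ν U < C + h
        U<C+h = subst (_< C + h) (sym ν-U) (<-trans mu<k (C+2+t<C+h t₀ t₀<n))
        W≤C+h : ν W ≤ C + h
        W≤C+h = subst (_≤ C + h) (sym ν-W) mw≤C+h

        fanVertex-unseen : ¬ Side S o (fanVertex t₀)
        fanVertex-unseen (inj₂ s) = miss s
        fanVertex-unseen (inj₁ e) = not-edge (edge-values e (proj₁ (fanVertex-in-half t₀ t₀<n)))
          where
          ν-k = ν-fanVertex t₀ t₀<n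
          not-edge : ν (fanVertex t₀) ≡ suc C ⊎ (C ≡ 0 × suc (ν (fanVertex t₀)) ≡ N) → ⊥
          not-edge (inj₁ k≡1+C) = <-irrefl (sym (trans (sym ν-k) k≡1+C)) 1+C<k
          not-edge (inj₂ (_ , 1+k≡N)) =
            <-irrefl 1+k≡N (s≤s (≤-<-trans (≤-reflexive ν-k) (<-≤-trans (C+2+t<C+h t₀ t₀<n) (≤-pred C+h<N))))

        unseen : ∀ t → ν U < ν t → ν t < ν W → ¬ Side S o t
        unseen t U<t t<W ot = by-position (<-cmp (ν t) k)
          where
          seen : Seen (ν t)
          seen = subst (Side S o) (sym (vertex-ν t (ν t) refl)) ot
          by-position : Tri (ν t < k) (ν t ≡ k) (k < ν t) → ⊥
          by-position (tri< t<k _ _) = unseen-above (ν t) (subst (_< ν t) ν-U U<t) t<k seen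
          by-position (tri> _ _ k<t) = unseen-below (ν t) k<t (subst (ν t <_) ν-W t<W) seen
          by-position (tri≈ _ t≡k _) = fanVertex-unseen (subst (Side S o) (ν-injective (trans t≡k (sym (ν-fanVertex t₀ t₀<n)))) ot)

        SUW : Support L U W
        SUW = side⇒support (triangle-closes sees-mu sees-mw C<U U<W unseen)
          where
          not-edge : ν W ≡ suc (ν U) ⊎ (ν U ≡ 0 × suc (ν W) ≡ N) → ⊥
          not-edge (inj₁ W≡1+U) = <⇒≱ mu<k (≤-pred (subst (k <_) (trans (sym ν-W) (trans W≡1+U (cong suc ν-U))) k<mw))
          not-edge (inj₂ (U≡0 , _)) = case subst (suc C ≤_) (trans (sym ν-U) U≡0) 1+C≤mu of λ ()
          side⇒support : Side S U W → Support L U W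
          side⇒support (inj₂ s) = s
          side⇒support (inj₁ e) = ⊥-elim (not-edge (edge-values e U<W))

        W≢σU : W ≢ σ U
        W≢σU W≡σU = [ (λ σU<C → <-asym (subst (_< C) (cong ν (sym W≡σU)) σU<C) (<-trans C<U U<W)) ,
                      (λ C+h<σU → <⇒≱ (subst (C + h <_) (cong ν (sym W≡σU)) C+h<σU) W≤C+h) ]
                    (σ-leaves-half U C<U U<C+h)

        module Apex (X : Vert) (U<X : ν U < ν X) (X<W : ν X < ν W) (UX : Side S U X) (XW : Side S X W)
                    (k' : Fin n) (UW-col : L U W ≡ col k') where
          C<X : C < ν X
          C<X = <-trans C<U U<X
          X<C+h : ν X < C + h
          X<C+h = <-≤-trans X<W W≤C+h

          Xo-diag : IsDiag X o
          Xo-diag = (ν<⇒≢ C<X ∘ sym) ,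
                    (λ e → <-asym C<X (subst (ν X <_) (sym (trans (cong ν e) (ν-nextV-< X X+1<N))) (subst (ν X <_) (+-comm 1 (ν X)) (n<1+n (ν X))))) ,
                    (λ e → <-irrefl (sym (trans (cong ν e) (trans (ν-nextV-< o C+1<N) (+-comm C 1)))) (≤-<-trans (subst (suc C ≤_) (sym ν-U) 1+C≤mu) U<X))
            where
            X+1<N : ν X + 1 < N
            X+1<N = ≤-<-trans (subst (_≤ C + h) (+-comm 1 (ν X)) X<C+h) C+h<N

          module Flipped = PairFlipStep (valid T) UW-col (cross-swapʳ (cross-sym (sorted⇒cross C<U U<X X<W))) Xo-diag
                             (σ-half≢o X C<X X<C+h ∘ sym) UX XW (side-sym sees-mw) sees-mu

          T' : ColoredCST
          T' = Flipped.T'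

          L' = lab T'

          central-o' : L' o (σ o) ≡ central
          central-o' = trans (Flipped.L'-other ¬Xo ¬UW) central-o
            where
            ¬Xo : ¬ SameSymPair X o o (σ o)
            ¬Xo (inj₁ (inj₁ (X≡o , _))) = ν<⇒≢ C<X (sym X≡o)
            ¬Xo (inj₁ (inj₂ (X≡σo , _))) = <-irrefl (trans (cong ν X≡σo) ν-σo) X<C+h
            ¬Xo (inj₂ (inj₁ (σX≡o , _))) = σ-half≢o X C<X X<C+h σX≡o
            ¬Xo (inj₂ (inj₂ (σX≡σo , _))) = ν<⇒≢ C<X (sym (σ-injective σX≡σo))
            ¬UW : ¬ SameSymPair U W o (σ o)
            ¬UW (inj₁ (inj₁ (U≡o , _))) = ν<⇒≢ C<U (sym U≡o)
            ¬UW (inj₁ (inj₂ (U≡σo , _))) = <-irrefl (trans (cong ν U≡σo) ν-σo) U<C+h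
            ¬UW (inj₂ (inj₁ (σU≡o , _))) = σ-half≢o U C<U U<C+h σU≡o
            ¬UW (inj₂ (inj₂ (σU≡σo , _))) = ν<⇒≢ C<U (sym (σ-injective σU≡σo))

          fan-diagonals-kept : ∀ y → C < ν y → ν y < C + h → Support L o y → Support L' o y
          fan-diagonals-kept y C<y y<C+h Soy = by-new (sameSymPair? X o o y)
            where
            ¬UW : ¬ SameSymPair U W o y
            ¬UW (inj₁ (inj₁ (U≡o , _))) = ν<⇒≢ C<U (sym U≡o)
            ¬UW (inj₁ (inj₂ (_ , W≡o))) = ν<⇒≢ (<-trans C<U U<W) (sym W≡o)
            ¬UW (inj₂ (inj₁ (σU≡o , _))) = σ-half≢o U C<U U<C+h σU≡o
            ¬UW (inj₂ (inj₂ (σU≡y , _))) = σ-half≢half U y C<U U<C+h C<y y<C+h σU≡y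
            by-new : Dec (SameSymPair X o o y) → Support L' o y
            by-new (yes Xo) = col⇒support {L'} (Flipped.L'-new Xo)
            by-new (no ¬Xo) = Soy ∘ trans (sym (Flipped.L'-other ¬Xo ¬UW))

          missing-decreases : missing T' < missing T
          missing-decreases =
            sum<-mono-< n (λ t t<n → indicator-mono (¬? (support? L' o (fanVertex t))) (¬? (support? L o (fanVertex t)))
                                       (λ ¬S' S → ¬S' (fan-diagonals-kept (fanVertex t) (proj₁ (fanVertex-in-half t t<n))
                                                                                     (proj₂ (fanVertex-in-half t t<n)) S)))
              tX tX<n
              (subst₂ _<_ (sym (indicator-no (¬? (support? L' o (fanVertex tX))) λ ¬S' → ¬S' (subst (Support L' o) (sym fanVertex-tX) S'oX)))
                          (sym (indicator-yes (¬? (support? L o (fanVertex tX))) (λ S → ¬SoX (subst (Support L o) fanVertex-tX S)))) ≤-refl)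
            where
            C+2≤X : C + 2 ≤ ν X
            C+2≤X = ≤-trans (≤-reflexive (+-comm C 2)) (≤-<-trans (subst (suc C ≤_) (sym ν-U) 1+C≤mu) U<X)
            tX : ℕ
            tX = ν X ∸ (C + 2)
            fanVertex-tX : fanVertex tX ≡ X
            fanVertex-tX = vertex-ν X _ (sym (m+[n∸m]≡n C+2≤X))
            tX<n : tX < n
            tX<n = +-cancelˡ-< (C + 2) tX n (subst₂ _<_ (sym (m+[n∸m]≡n C+2≤X)) (trans (cong (C +_) (+-comm n 2)) (sym (+-assoc C 2 n))) X<C+h)
            S'oX : Support L' o X
            S'oX = col⇒support {L'} (Flipped.L'-new (inj₁ (inj₂ (refl , refl))))
            ¬SoX : ¬ Support L o X
            ¬SoX S = unseen X U<X X<W (inj₂ S)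

        add-missing : ∃[ T' ] Reachable T T' × lab T' o (σ o) ≡ central × missing T' < missing T
        add-missing = by-apex (triangle-apex (inj₂ SUW) (subst₂ (λ a b → suc a < b) (sym ν-U) (sym ν-W) (≤-trans (s≤s mu<k) k<mw)))
          where
          by-apex : ∃[ X ] ν U < ν X × ν X < ν W × Side S U X × Side S X W →
                    ∃[ T' ] Reachable T T' × lab T' o (σ o) ≡ central × missing T' < missing T
          by-apex (X , U<X , X<W , UX , XW) = by-color (support-col SUW W≢σU)
            where
            by-color : ∃[ k' ] L U W ≡ col k' → ∃[ T' ] Reachable T T' × lab T' o (σ o) ≡ central × missing T' < missing T
            by-color (k' , UW-col) = A.T' , flip⇒reachable (inj₂ A.Flipped.flip) , A.central-o' , A.missing-decreases
              where module A = Apex X U<X X<W UX XW k' UW-col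

      add-missing : ∃[ T' ] Reachable T T' × lab T' o (σ o) ≡ central × missing T' < missing T
      add-missing = around (greatestBelow (λ m → side? L o (vertex m)) sees-next 1+C<k)
                           (leastAbove (λ m → side? L o (vertex m)) sees-σo (C+2+t<C+h t₀ t₀<n))
        where
        around : ∃[ mu ] suc C ≤ mu × mu < k × Seen mu × (∀ y → mu < y → y < k → ¬ Seen y) →
                 ∃[ mw ] k < mw × mw ≤ C + h × Seen mw × (∀ y → k < y → y < mw → ¬ Seen y) →
                 ∃[ T' ] Reachable T T' × lab T' o (σ o) ≡ central × missing T' < missing T
        around (mu , 1+C≤mu , mu<k , sees-mu , unseen-above) (mw , k<mw , mw≤C+h , sees-mw , unseen-below) =
          Between.add-missing mu 1+C≤mu mu<k sees-mu unseen-above mw k<mw mw≤C+h sees-mw unseen-below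

    fan : ∀ T → lab T o (σ o) ≡ central → ∃[ T' ] Reachable T T' × Fan T'
    fan T central-o = go (suc (missing T)) T central-o ≤-refl
      where
      go : ∀ fuel T → lab T o (σ o) ≡ central → missing T < fuel → ∃[ T' ] Reachable T T' × Fan T'
      go (suc fuel) T central-o missing<1+fuel = by-search (anyUpTo? (λ t → ¬? (support? (lab T) o (fanVertex t))) n)
        where
        continue : ∃[ T' ] Reachable T T' × lab T' o (σ o) ≡ central × missing T' < missing T → ∃[ T'' ] Reachable T T'' × Fan T''
        continue (T' , T→T' , central-o' , fewer) = prepend (go fuel T' central-o' (<-≤-trans fewer (≤-pred missing<1+fuel)))
          where
          prepend : ∃[ T'' ] Reachable T' T'' × Fan T'' → ∃[ T'' ] Reachable T T'' × Fan T''
          prepend (T'' , T'→T'' , fan'') = T'' , reachable-trans T→T' T'→T'' , fan''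
        by-search : Dec (∃ λ t → t < n × ¬ Support (lab T) o (fanVertex t)) → ∃[ T' ] Reachable T T' × Fan T'
        by-search (no none-missing) = T , reachable-refl {T} , central-o ,
          λ t t<n → decidable-stable (support? (lab T) o (fanVertex t)) (λ ¬S → none-missing (t , t<n , ¬S))
        by-search (yes (t₀ , t₀<n , miss)) = continue (Step.add-missing T central-o t₀ t₀<n miss)

  -- Moving the central diagonal down to vertex 0

  -- With the central diagonal at o and its fan present, B = o + n + 1 lies just before σ o, so
  -- o B σ o σ B is a quadrilateral whose central flip yields the central diagonal {σ B, B}, and
  -- σ B = o − 1.
  module ShiftDown (c : ℕ) (o : Vert) (ν-o : ν o ≡ suc c) (o<h : ν o < h) (T : ColoredCST)
                   (fan-o : FanAt.Fan o o<h T) where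
    open FanAt o o<h
    L = lab T
    open Triangulated (valid T)

    B : Vert
    B = vertex (C + suc n)
    1+n<h : suc n < h
    1+n<h = subst (suc n <_) (+-comm 2 n) (n<1+n (suc n))
    ν-B : ν B ≡ C + suc n
    ν-B = ν-vertex _ (<-trans (+-monoʳ-< C 1+n<h) C+h<N)
    h≤B : h ≤ ν B
    h≤B = subst (h ≤_) (sym ν-B) (≤-trans (≤-reflexive (+-comm n 2)) (subst (suc (suc n) ≤_) (cong (_+ suc n) (sym ν-o)) (s≤s (m≤n+m (suc n) c))))
    ν-σB : ν (σ B) ≡ c
    ν-σB = +-cancelʳ-≡ h (ν (σ B)) c (begin
      ν (σ B) + h             ≡⟨ ν-σ-high B h≤B ⟩
      ν B                     ≡⟨ ν-B ⟩
      C + suc n               ≡⟨ cong (_+ suc n) ν-o ⟩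
      suc c + suc n           ≡⟨ sym (+-suc c (suc n)) ⟩
      c + suc (suc n)         ≡⟨ cong (c +_) (+-comm 2 n) ⟩
      c + h                   ∎)
      where open ≡-Reasoning
    c<C : c < C
    c<C = subst (c <_) (sym ν-o) (n<1+n c)
    C<B : C < ν B
    C<B = subst (C <_) (sym ν-B) (m<m+n C (s≤s z≤n))
    B<σo : ν B < ν (σ o)
    B<σo = subst₂ _<_ (sym ν-B) (sym ν-σo) (+-monoʳ-< C 1+n<h)
    ν-nextV-B : ν (nextV B) ≡ ν (σ o)
    ν-nextV-B = trans (ν-nextV-< B (subst (_< N) (+-comm 1 (ν B)) (≤-<-trans B<σo (ν<N (σ o)))))
                      (trans (cong (_+ 1) ν-B) (trans (+-assoc C (suc n) 1) (trans (cong (C +_) (trans (+-comm (suc n) 1) (+-comm 2 n))) (sym ν-σo))))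
    ν-nextV-σB : ν (nextV (σ B)) ≡ ν o
    ν-nextV-σB = trans (ν-nextV-< (σ B) (subst (_< N) (sym σB+1≡o) (ν<N o))) σB+1≡o
      where σB+1≡o = trans (cong (_+ 1) ν-σB) (trans (+-comm c 1) (sym ν-o))
    Bσ-diag : IsDiag B (σ B)
    Bσ-diag = σ-no-fixpoint B ∘ sym ,
              (λ e → <-irrefl (trans (sym ν-σB) (trans (cong ν e) ν-nextV-B)) (<-≤-trans c<C (subst (C ≤_) (sym ν-σo) (m≤m+n C h)))) ,
              (λ e → <-irrefl (sym (trans (cong ν e) ν-nextV-σB)) C<B)
    oB : Side S o B
    oB = last-fan-side n refl
      where
      last-fan-side : ∀ m → m ≡ n → Side S o B
      last-fan-side zero refl = inj₁ (inj₁ (ν-injective (trans ν-B (sym (trans (ν-nextV-< o C+1<N) (cong (C +_) refl))))))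
      last-fan-side (suc m) refl = inj₂ (subst (Support L o) (cong vertex (+-assoc C 2 m)) (proj₂ fan-o m (n<1+n m)))

    module Central = CentralFlipStep (valid T) (proj₁ fan-o) (cross-swapʳ (cross-sym (sorted⇒cross (subst (_< C) (sym ν-σB) c<C) C<B B<σo)))
                       Bσ-diag oB (inj₁ (inj₁ (ν-injective (sym ν-nextV-B)))) (side-σ oB) (inj₁ (inj₁ (ν-injective (sym ν-nextV-σB))))

    σB<h : ν (σ B) < h
    σB<h = subst (_< h) (sym ν-σB) (<-trans c<C o<h)

    central-σB : lab Central.T' (σ B) (σ (σ B)) ≡ central
    central-σB = subst (λ z → lab Central.T' (σ B) z ≡ central) (sym (σ-involutive B))
                   (trans (CST.symmetric (valid Central.T') (σ B) B) (Central.L'-new sameSymPair-refl))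

  origin : Vert
  origin = vertex 0

  ν-origin : ν origin ≡ 0
  ν-origin = ν-vertex 0 (s≤s z≤n)

  origin<h : ν origin < h
  origin<h = subst (_< h) (sym ν-origin) (≤-trans (s≤s z≤n) 2≤h)

  Fan₀ : ColoredCST → Set
  Fan₀ = FanAt.Fan origin origin<h

  reach-fan₀ : ∀ T → ∃[ T' ] Reachable T T' × Fan₀ T'
  reach-fan₀ T = from-central (Triangulated.central-diagonal (valid T))
    where
    at-origin : ∀ {T o} → o ≡ origin → (o<h : ν o < h) → ∃[ T' ] Reachable T T' × FanAt.Fan o o<h T' →
                ∃[ T' ] Reachable T T' × Fan₀ T'
    at-origin refl _ reached = reached
    descend : ∀ m T o → ν o ≡ m → (o<h : ν o < h) → lab T o (σ o) ≡ central → ∃[ T' ] Reachable T T' × Fan₀ T'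
    descend zero T o ν-o≡0 o<h central-o = at-origin (ν-injective (trans ν-o≡0 (sym ν-origin))) o<h (FanAt.fan o o<h T central-o)
    descend (suc c) T o ν-o o<h central-o = shift (FanAt.fan o o<h T central-o)
      where
      shift : ∃[ T₁ ] Reachable T T₁ × FanAt.Fan o o<h T₁ → ∃[ T' ] Reachable T T' × Fan₀ T'
      shift (T₁ , T→T₁ , fan₁) = prepend (descend c S.Central.T' (σ S.B) S.ν-σB S.σB<h S.central-σB)
        where
        module S = ShiftDown c o ν-o o<h T₁ fan₁
        prepend : ∃[ T' ] Reachable S.Central.T' T' × Fan₀ T' → ∃[ T' ] Reachable T T' × Fan₀ T'
        prepend (T' , T₂→T' , fan') = T' , reachable-trans T→T₁ (reachable-trans (flip⇒reachable (inj₁ S.Central.flip)) T₂→T') , fan'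
    from-central : ∃[ c ] ν c < h × lab T c (σ c) ≡ central → ∃[ T' ] Reachable T T' × Fan₀ T'
    from-central (c , c<h , central-c) = descend (ν c) T c refl c<h central-c

  -- A fan at vertex 0 is determined by the colors of its diagonals

  module F₀ = FanAt origin origin<h

  fanVertex₀ : ℕ → Vert
  fanVertex₀ = F₀.fanVertex

  ν-fanVertex₀ : ∀ t → t < n → ν (fanVertex₀ t) ≡ 2 + t
  ν-fanVertex₀ = F₀.ν-fanVertex

  2+t<h : ∀ t → t < n → 2 + t < h
  2+t<h = F₀.C+2+t<C+h

  ν-σ-origin : ν (σ origin) ≡ h
  ν-σ-origin = ν-σ-low origin origin<h

  ν-σ-fanVertex₀ : ∀ t → t < n → ν (σ (fanVertex₀ t)) ≡ 2 + t + h
  ν-σ-fanVertex₀ t t<n = trans (ν-σ-low (fanVertex₀ t) (subst (_< h) (sym (ν-fanVertex₀ t t<n)) (2+t<h t t<n)))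
                               (cong (_+ h) (ν-fanVertex₀ t t<n))

  fan-at : ∀ x → 2 ≤ x → x < h → ∃[ t ] t < n × ν (fanVertex₀ t) ≡ x
  fan-at (suc (suc t)) (s≤s (s≤s z≤n)) 2+t<h = t , t<n , ν-fanVertex₀ t t<n
    where t<n = +-cancelʳ-< 2 t n (subst (_< n + 2) (+-comm 2 t) 2+t<h)

  σ-fan-at : ∀ x → 2 + h ≤ x → x < N → ∃[ t ] t < n × ν (σ (fanVertex₀ t)) ≡ x
  σ-fan-at x 2+h≤x x<N with fan-at (x ∸ h) 2≤x-h x-h<h
    where
    h≤x = ≤-trans (m≤n+m h 2) 2+h≤x
    2≤x-h = +-cancelʳ-≤ h 2 (x ∸ h) (subst (2 + h ≤_) (sym (m∸n+n≡m h≤x)) 2+h≤x)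
    x-h<h = +-cancelʳ-< h (x ∸ h) h (subst₂ _<_ (sym (m∸n+n≡m h≤x)) N≡h+h x<N)
  ... | t , t<n , ν-t = t , t<n , trans (ν-σ-fanVertex₀ t t<n) (trans (cong (_+ h) (sym (ν-fanVertex₀ t t<n)))
                                   (trans (cong (_+ h) ν-t) (m∸n+n≡m (≤-trans (m≤n+m h 2) 2+h≤x))))

  FanPair₀ : Vert → Vert → Set
  FanPair₀ i j = (∃[ t ] t < n × SameSymPair origin (fanVertex₀ t) i j) ⊎ SamePair origin (σ origin) i j

  fanPair₀? : ∀ i j → Dec (FanPair₀ i j)
  fanPair₀? i j = anyUpTo? (λ t → sameSymPair? origin (fanVertex₀ t) i j) n ⊎-dec samePair? origin (σ origin) i j

  fanPair₀-swap : ∀ {i j} → FanPair₀ j i → FanPair₀ i j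
  fanPair₀-swap (inj₁ (t , t<n , p)) = inj₁ (t , t<n , sameSymPair-swap p)
  fanPair₀-swap (inj₂ p) = inj₂ (samePair-sym (samePair-swap (samePair-sym p)))

  isDiag⇒nonadjacent : ∀ {i j} → IsDiag i j → ν i < ν j → suc (ν i) < ν j
  isDiag⇒nonadjacent {i} {j} (_ , j≢i+1 , _) i<j with suc (ν i) ≟ ν j
  ... | yes 1+i≡j = contradiction (ν-injective (trans (sym 1+i≡j) (sym (trans (ν-nextV-< i (subst (_< N) (+-comm 1 (ν i)) (≤-<-trans i<j (ν<N j)))) (+-comm (ν i) 1))))) j≢i+1
  ... | no 1+i≢j = ≤∧≢⇒< i<j 1+i≢j

  isDiag⇒¬last : ∀ {i j} → IsDiag i j → ν i ≡ 0 → suc (ν j) < N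
  isDiag⇒¬last {i} {j} (_ , _ , i≢j+1) i≡0 with suc (ν j) ≟ N
  ... | yes 1+j≡N = contradiction (ν-injective (trans i≡0 (sym (ν-nextV-last j (trans (+-comm (ν j) 1) 1+j≡N))))) i≢j+1
  ... | no 1+j≢N = ≤∧≢⇒< (ν<N j) 1+j≢N

  -- Every other diagonal crosses a diagonal of the fan or of its mirror image.
  module FanDiagonals (T : ColoredCST) (fan : Fan₀ T) where
    L = lab T
    open CST (valid T)

    Crossed : Vert → Vert → Set
    Crossed i j = ∃[ k ] ∃[ l ] (Support L k l × Cross k l i j)

    S-fan : ∀ t → t < n → Support L origin (fanVertex₀ t)
    S-fan = proj₂ fan

    S-central : Support L origin (σ origin)
    S-central = central⇒support {L} (proj₁ fan)

    crossed-sorted : ∀ i j → ν i < ν j → IsDiag i j → ¬ FanPair₀ i j → Crossed i j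
    crossed-sorted i j i<j ij-diag ¬fan = by-j (ν j ≤? h)
      where
      1+i<j : suc (ν i) < ν j
      1+i<j = isDiag⇒nonadjacent ij-diag i<j
      0<i : ν i ≢ 0 → ν origin < ν i
      0<i i≢0 = subst (_< ν i) (sym ν-origin) (≤∧≢⇒< z≤n (i≢0 ∘ sym))
      origin≡i : ν i ≡ 0 → origin ≡ i
      origin≡i i≡0 = ν-injective (trans ν-origin (sym i≡0))

      fan-pair : ν i ≡ 0 → ∃[ t ] t < n × ν (fanVertex₀ t) ≡ ν j → Crossed i j
      fan-pair i≡0 (t , t<n , ν-t) = contradiction (inj₁ (t , t<n , inj₁ (inj₁ (origin≡i i≡0 , ν-injective ν-t)))) ¬fan
      σ-fan-pair : ν i ≡ h → ∃[ t ] t < n × ν (σ (fanVertex₀ t)) ≡ ν j → Crossed i j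
      σ-fan-pair i≡h (t , t<n , ν-σt) =
        contradiction (inj₁ (t , t<n , inj₂ (inj₁ (ν-injective (trans ν-σ-origin (sym i≡h)) , ν-injective ν-σt)))) ¬fan
      crossed-by-fan : ν i ≢ 0 → ∃[ t ] t < n × ν (fanVertex₀ t) ≡ suc (ν i) → Crossed i j
      crossed-by-fan i≢0 (t , t<n , ν-t) = origin , fanVertex₀ t , S-fan t t<n ,
        sorted⇒cross (0<i i≢0) (subst (ν i <_) (sym ν-t) (n<1+n (ν i))) (subst (_< ν j) (sym ν-t) 1+i<j)
      crossed-by-σ-fan-j : ν i ≡ 0 → h < ν j → ∃[ t ] t < n × ν (σ (fanVertex₀ t)) ≡ suc (ν j) → Crossed i j
      crossed-by-σ-fan-j i≡0 h<j (t , t<n , ν-σt) = σ origin , σ (fanVertex₀ t) , support-σ (S-fan t t<n) ,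
        cross-sym (sorted⇒cross (subst₂ _<_ (sym i≡0) (sym ν-σ-origin) (≤-trans (s≤s z≤n) 2≤h))
                                (subst (_< ν j) (sym ν-σ-origin) h<j) (subst (ν j <_) (sym ν-σt) (n<1+n (ν j))))
      crossed-by-σ-fan-i : h < ν i → ∃[ t ] t < n × ν (σ (fanVertex₀ t)) ≡ suc (ν i) → Crossed i j
      crossed-by-σ-fan-i h<i (t , t<n , ν-σt) = σ origin , σ (fanVertex₀ t) , support-σ (S-fan t t<n) ,
        sorted⇒cross (subst (_< ν i) (sym ν-σ-origin) h<i) (subst (ν i <_) (sym ν-σt) (n<1+n (ν i))) (subst (_< ν j) (sym ν-σt) 1+i<j)

      low-from-origin : ν j ≤ h → ν i ≡ 0 → Dec (ν j ≡ h) → Crossed i j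
      low-from-origin _ i≡0 (yes j≡h) =
        contradiction (inj₂ (inj₁ (origin≡i i≡0 , ν-injective (trans ν-σ-origin (sym j≡h))))) ¬fan
      low-from-origin j≤h i≡0 (no j≢h) = fan-pair i≡0 (fan-at (ν j) (subst (λ z → suc z < ν j) i≡0 1+i<j) (≤∧≢⇒< j≤h j≢h))
      low : ν j ≤ h → Dec (ν i ≡ 0) → Crossed i j
      low j≤h (yes i≡0) = low-from-origin j≤h i≡0 (ν j ≟ h)
      low j≤h (no i≢0) = crossed-by-fan i≢0 (fan-at (suc (ν i)) (s≤s (≤∧≢⇒< z≤n (i≢0 ∘ sym))) (<-≤-trans 1+i<j j≤h))
      high-from-low : h < ν j → ν i < h → Dec (ν i ≡ 0) → Crossed i j
      high-from-low h<j i<h (no i≢0) = origin , σ origin , S-central ,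
        sorted⇒cross (0<i i≢0) (subst (ν i <_) (sym ν-σ-origin) i<h) (subst (_< ν j) (sym ν-σ-origin) h<j)
      high-from-low h<j i<h (yes i≡0) = crossed-by-σ-fan-j i≡0 h<j (σ-fan-at (suc (ν j)) (s≤s h<j) (isDiag⇒¬last ij-diag i≡0))
      high : h < ν j → Tri (ν i < h) (ν i ≡ h) (h < ν i) → Crossed i j
      high h<j (tri< i<h _ _) = high-from-low h<j i<h (ν i ≟ 0)
      high h<j (tri≈ _ i≡h _) = σ-fan-pair i≡h (σ-fan-at (ν j) (subst (λ z → suc (suc z) ≤ ν j) i≡h 1+i<j) (ν<N j))
      high h<j (tri> _ _ h<i) = crossed-by-σ-fan-i h<i (σ-fan-at (suc (ν i)) (s≤s h<i) (<-trans 1+i<j (ν<N j)))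
      by-j : Dec (ν j ≤ h) → Crossed i j
      by-j (yes j≤h) = low j≤h (ν i ≟ 0)
      by-j (no j≰h) = high (≰⇒> j≰h) (<-cmp (ν i) h)

    crossed : ∀ i j → IsDiag i j → ¬ FanPair₀ i j → Crossed i j
    crossed i j ij-diag ¬fan = by-order (<-cmp (ν i) (ν j))
      where
      swapped : Crossed j i → Crossed i j
      swapped (k , l , Skl , kl×ji) = k , l , Skl , cross-swapʳ kl×ji
      by-order : Tri (ν i < ν j) (ν i ≡ ν j) (ν j < ν i) → Crossed i j
      by-order (tri< i<j _ _) = crossed-sorted i j i<j ij-diag ¬fan
      by-order (tri≈ _ i≡j _) = contradiction (ν-injective i≡j) (proj₁ ij-diag)
      by-order (tri> _ _ j<i) = swapped (crossed-sorted j i j<i (isDiag-sym ij-diag) (¬fan ∘ fanPair₀-swap))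

    non-fan-absent : ∀ i j → ¬ FanPair₀ i j → L i j ≡ none
    non-fan-absent i j ¬fan = ¬support⇒none {L} (λ Sij → absent Sij (crossed i j (support⇒isDiag i j Sij) ¬fan))
      where
      absent : Support L i j → ¬ Crossed i j
      absent Sij (k , l , Skl , kl×ij) = noncrossing k l i j Skl Sij kl×ij

  fan₀-determined : ∀ T T' → Fan₀ T → Fan₀ T' → (∀ t → t < n → lab T origin (fanVertex₀ t) ≡ lab T' origin (fanVertex₀ t)) →
                    SameCST T T'
  fan₀-determined T T' fan fan' same-colors i j = by-pair (fanPair₀? i j)
    where
    by-pair : Dec (FanPair₀ i j) → lab T i j ≡ lab T' i j
    by-pair (yes (inj₁ (t , t<n , p))) =
      trans (sym (CST.label-sameSymPair (valid T) p)) (trans (same-colors t t<n) (CST.label-sameSymPair (valid T') p))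
    by-pair (yes (inj₂ p)) =
      trans (sym (CST.label-sameSymPair (valid T) (inj₁ p))) (trans (proj₁ fan) (trans (sym (proj₁ fan')) (CST.label-sameSymPair (valid T') (inj₁ p))))
    by-pair (no ¬fan) = trans (FanDiagonals.non-fan-absent T fan i j ¬fan) (sym (FanDiagonals.non-fan-absent T' fan' i j ¬fan))

  record FlipResult (T : ColoredCST) (a c b d : Vert) (k : Fin n) : Set where
    field
      T' : ColoredCST
      reachable : Reachable T T'
      flipped-label : lab T' b d ≡ col k
      kept : ∀ i j → ¬ SameSymPair a c i j → ¬ SameSymPair b d i j → lab T' i j ≡ lab T i j

  pair-flip : ∀ T {a c b d} {k} → lab T a c ≡ col k → Cross a c b d → IsDiag b d → d ≢ σ b →
              Side (Support (lab T)) a b → Side (Support (lab T)) b c → Side (Support (lab T)) c d → Side (Support (lab T)) d a →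
              FlipResult T a c b d k
  pair-flip T ac-col ac×bd bd-diag d≢σb ab bc cd da = record
    { T' = P.T'
    ; reachable = flip⇒reachable (inj₂ P.flip)
    ; flipped-label = P.L'-new sameSymPair-refl
    ; kept = λ i j ¬ac ¬bd → P.L'-other ¬bd ¬ac
    }
    where module P = PairFlipStep (valid T) ac-col ac×bd bd-diag d≢σb ab bc cd da

  side-kept : ∀ {T T' : ColoredCST} {p q} → lab T' p q ≡ lab T p q → Side (Support (lab T)) p q → Side (Support (lab T')) p q
  side-kept e (inj₁ pq) = inj₁ pq
  side-kept e (inj₂ Spq) = inj₂ (Spq ∘ trans (sym e))

  Inner : Vert → Set
  Inner p = 0 < ν p × ν p < h

  σ-inner≢low : ∀ {p r} → Inner p → ν r ≤ h → σ p ≢ r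
  σ-inner≢low {p} (0<p , p<h) r≤h σp≡r =
    <⇒≱ (subst (h <_) (sym (ν-σ-low p p<h)) (subst (h <_) (+-comm h (ν p)) (m<m+n h 0<p))) (subst (_≤ h) (sym (cong ν σp≡r)) r≤h)

  ¬sameSymPair-low : ∀ {p q r s} → Inner p ⊎ Inner q → ν r ≤ h → ν s ≤ h →
                     (ν p ≢ ν r ⊎ ν q ≢ ν s) → (ν p ≢ ν s ⊎ ν q ≢ ν r) → ¬ SameSymPair p q r s
  ¬sameSymPair-low _ _ _ p≢r⊎q≢s p≢s⊎q≢r (inj₁ same) =
    ¬samePair (Data.Sum.map (_∘ cong ν) (_∘ cong ν) p≢r⊎q≢s) (Data.Sum.map (_∘ cong ν) (_∘ cong ν) p≢s⊎q≢r) same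
  ¬sameSymPair-low (inj₁ inner-p) r≤h _ _ _ (inj₂ (inj₁ (σp≡r , _))) = σ-inner≢low inner-p r≤h σp≡r
  ¬sameSymPair-low (inj₁ inner-p) _ s≤h _ _ (inj₂ (inj₂ (σp≡s , _))) = σ-inner≢low inner-p s≤h σp≡s
  ¬sameSymPair-low (inj₂ inner-q) _ s≤h _ _ (inj₂ (inj₁ (_ , σq≡s))) = σ-inner≢low inner-q s≤h σq≡s
  ¬sameSymPair-low (inj₂ inner-q) r≤h _ _ _ (inj₂ (inj₂ (_ , σq≡r))) = σ-inner≢low inner-q r≤h σq≡r

  low-isDiag : ∀ {p q} → suc (ν p) < ν q → ν q ≤ h → IsDiag p q
  low-isDiag {p} {q} 1+p<q q≤h =
    <⇒≢ (<-trans (n<1+n (ν p)) 1+p<q) ∘ cong ν ,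
    >⇒≢ 1+p<q ∘ (λ e → trans (cong ν e) (trans (ν-nextV-< p p+1<N) (+-comm (ν p) 1))) ,
    <⇒≢ (<-trans (n<1+n (ν p)) (<-trans 1+p<q (subst (ν q <_) (sym (trans (ν-nextV-< q q+1<N) (+-comm (ν q) 1))) (n<1+n (ν q))))) ∘ cong ν
    where
    1+h<N : suc h < N
    1+h<N = subst (suc h <_) (sym N≡h+h) (subst (_< h + h) (+-comm h 1) (+-monoʳ-< h (≤-trans (s≤s (s≤s z≤n)) 2≤h)))
    q+1<N : ν q + 1 < N
    q+1<N = subst (_< N) (+-comm 1 (ν q)) (≤-<-trans (s≤s q≤h) 1+h<N)
    p+1<N : ν p + 1 < N
    p+1<N = subst (_< N) (+-comm 1 (ν p)) (<-≤-trans 1+p<q (≤-trans q≤h (<⇒≤ h<N)))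

  successor⇒edge : ∀ {p q} → ν q ≡ suc (ν p) → ν q < N → Edge p q
  successor⇒edge {p} {q} q≡1+p q<N =
    inj₁ (ν-injective (trans q≡1+p (trans (+-comm 1 (ν p)) (sym (ν-nextV-< p (subst (_< N) (trans q≡1+p (+-comm 1 (ν p))) q<N))))))

  -- The five pair flips {0,2} → {1,3} → … → {3,0} (indices of the pentagon 0, j + 1, …, j + 4)
  -- run once around the flip cycle of the pentagon and exchange the colors of {0, j + 2} and
  -- {0, j + 3}; every other fan diagonal is untouched.
  module Exchange (T : ColoredCST) (fan : Fan₀ T) (j : ℕ) (2+j≤n : suc j < n) where
    j<n : j < n
    j<n = <-trans (n<1+n j) 2+j≤n
    4+j≤h : 4 + j ≤ h
    4+j≤h = subst (4 + j ≤_) (+-comm 2 n) (s≤s (s≤s 2+j≤n))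

    p₀ p₁ p₂ p₃ p₄ : Vert
    p₀ = origin
    p₁ = vertex (suc j)
    p₂ = fanVertex₀ j
    p₃ = fanVertex₀ (suc j)
    p₄ = vertex (4 + j)

    ν-p₀ : ν p₀ ≡ 0
    ν-p₀ = ν-origin
    ν-p₁ : ν p₁ ≡ 1 + j
    ν-p₁ = ν-vertex _ (<-≤-trans (s≤s (≤-trans (n≤1+n (suc j)) (n≤1+n (suc (suc j))))) (≤-trans 4+j≤h (<⇒≤ h<N)))
    ν-p₂ : ν p₂ ≡ 2 + j
    ν-p₂ = ν-fanVertex₀ j j<n
    ν-p₃ : ν p₃ ≡ 3 + j
    ν-p₃ = ν-fanVertex₀ (suc j) 2+j≤n
    ν-p₄ : ν p₄ ≡ 4 + j
    ν-p₄ = ν-vertex _ (≤-<-trans 4+j≤h h<N)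

    p₀<p₁ : ν p₀ < ν p₁
    p₀<p₁ = subst₂ _<_ (sym ν-p₀) (sym ν-p₁) (s≤s z≤n)
    p₁<p₂ : ν p₁ < ν p₂
    p₁<p₂ = subst₂ _<_ (sym ν-p₁) (sym ν-p₂) ≤-refl
    p₂<p₃ : ν p₂ < ν p₃
    p₂<p₃ = subst₂ _<_ (sym ν-p₂) (sym ν-p₃) ≤-refl
    p₃<p₄ : ν p₃ < ν p₄
    p₃<p₄ = subst₂ _<_ (sym ν-p₃) (sym ν-p₄) ≤-refl
    p₀<p₂ = <-trans p₀<p₁ p₁<p₂
    p₀<p₃ = <-trans p₀<p₂ p₂<p₃
    p₀<p₄ = <-trans p₀<p₃ p₃<p₄
    p₁<p₃ = <-trans p₁<p₂ p₂<p₃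
    p₁<p₄ = <-trans p₁<p₃ p₃<p₄
    p₂<p₄ = <-trans p₂<p₃ p₃<p₄

    p₄≤h : ν p₄ ≤ h
    p₄≤h = subst (_≤ h) (sym ν-p₄) 4+j≤h
    p₃≤h = ≤-trans (<⇒≤ p₃<p₄) p₄≤h
    p₂≤h = ≤-trans (<⇒≤ p₂<p₄) p₄≤h
    p₁≤h = ≤-trans (<⇒≤ p₁<p₄) p₄≤h
    p₀≤h = ≤-trans (<⇒≤ p₀<p₄) p₄≤h

    inner₁ : Inner p₁
    inner₁ = subst (0 <_) (sym ν-p₁) (s≤s z≤n) , <-≤-trans p₁<p₄ p₄≤h
    inner₂ : Inner p₂
    inner₂ = <-trans (proj₁ inner₁) p₁<p₂ , <-≤-trans p₂<p₄ p₄≤h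
    inner₃ : Inner p₃
    inner₃ = <-trans (proj₁ inner₂) p₂<p₃ , <-≤-trans p₃<p₄ p₄≤h

    edge₁₂ : Edge p₁ p₂
    edge₁₂ = successor⇒edge (trans ν-p₂ (cong suc (sym ν-p₁))) (ν<N p₂)
    edge₂₃ : Edge p₂ p₃
    edge₂₃ = successor⇒edge (trans ν-p₃ (cong suc (sym ν-p₂))) (ν<N p₃)
    edge₃₄ : Edge p₃ p₄
    edge₃₄ = successor⇒edge (trans ν-p₄ (cong suc (sym ν-p₃))) (ν<N p₄)

    L = lab T
    open CST (valid T)

    S-fan : ∀ t → t < n → Support L origin (fanVertex₀ t)
    S-fan = proj₂ fan

    fan≢σorigin : ∀ t → t < n → fanVertex₀ t ≢ σ origin
    fan≢σorigin t t<n e = <-irrefl (trans (sym (ν-fanVertex₀ t t<n)) (trans (cong ν e) ν-σ-origin)) (2+t<h t t<n)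

    A B : Fin n
    A = proj₁ (support-col (S-fan j j<n) (fan≢σorigin j j<n))
    B = proj₁ (support-col (S-fan (suc j) 2+j≤n) (fan≢σorigin (suc j) 2+j≤n))
    p₀p₂-col : L p₀ p₂ ≡ col A
    p₀p₂-col = proj₂ (support-col (S-fan j j<n) (fan≢σorigin j j<n))
    p₀p₃-col : L p₀ p₃ ≡ col B
    p₀p₃-col = proj₂ (support-col (S-fan (suc j) 2+j≤n) (fan≢σorigin (suc j) 2+j≤n))

    side₀₁ : Side (Support L) p₀ p₁
    side₀₁ = previous j refl
      where
      previous : ∀ i → i ≡ j → Side (Support L) p₀ p₁
      previous zero refl = inj₁ (successor⇒edge (trans ν-p₁ (cong suc (sym ν-p₀))) (ν<N p₁))
      previous (suc i) refl = inj₂ (S-fan i (<-trans (n<1+n i) j<n))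
    S₄₀ : Support L p₄ p₀
    S₄₀ = support-sym (next (suc (suc j) ≟ n))
      where
      next : Dec (suc (suc j) ≡ n) → Support L p₀ p₄
      next (no 2+j≢n) = S-fan (suc (suc j)) (≤∧≢⇒< 2+j≤n 2+j≢n)
      next (yes 2+j≡n) = subst (Support L p₀) (ν-injective (trans ν-σ-origin (trans (trans (+-comm n 2) (cong (2 +_) (sym 2+j≡n))) (sym ν-p₄))))
                           (central⇒support {L} (proj₁ fan))

    flip₁ : FlipResult T p₀ p₂ p₁ p₃ A
    flip₁ = pair-flip T p₀p₂-col (sorted⇒cross p₀<p₁ p₁<p₂ p₂<p₃)
              (low-isDiag (subst₂ _<_ (cong suc (sym ν-p₁)) (sym ν-p₃) ≤-refl) p₃≤h) (σ-inner≢low inner₁ p₃≤h ∘ sym)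
              side₀₁ (inj₁ edge₁₂) (inj₁ edge₂₃) (inj₂ (support-sym (S-fan (suc j) 2+j≤n)))
    module F₁ = FlipResult flip₁
    T₁ = F₁.T'

    p02≁p03 : ¬ SameSymPair p₀ p₂ p₀ p₃
    p02≁p03 = ¬sameSymPair-low (inj₂ inner₂) p₀≤h p₃≤h (inj₂ (<⇒≢ p₂<p₃)) (inj₁ (<⇒≢ p₀<p₃))
    p13≁p03 : ¬ SameSymPair p₁ p₃ p₀ p₃
    p13≁p03 = ¬sameSymPair-low (inj₁ inner₁) p₀≤h p₃≤h (inj₁ (>⇒≢ p₀<p₁)) (inj₁ (<⇒≢ p₁<p₃))
    p02≁p01 : ¬ SameSymPair p₀ p₂ p₀ p₁
    p02≁p01 = ¬sameSymPair-low (inj₂ inner₂) p₀≤h p₁≤h (inj₂ (>⇒≢ p₁<p₂)) (inj₁ (<⇒≢ p₀<p₁))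
    p13≁p01 : ¬ SameSymPair p₁ p₃ p₀ p₁
    p13≁p01 = ¬sameSymPair-low (inj₁ inner₁) p₀≤h p₁≤h (inj₁ (>⇒≢ p₀<p₁)) (inj₂ (>⇒≢ p₀<p₃))
    p02≁p40 : ¬ SameSymPair p₀ p₂ p₄ p₀
    p02≁p40 = ¬sameSymPair-low (inj₂ inner₂) p₄≤h p₀≤h (inj₁ (<⇒≢ p₀<p₄)) (inj₂ (<⇒≢ p₂<p₄))
    p13≁p40 : ¬ SameSymPair p₁ p₃ p₄ p₀
    p13≁p40 = ¬sameSymPair-low (inj₁ inner₁) p₄≤h p₀≤h (inj₁ (<⇒≢ p₁<p₄)) (inj₁ (>⇒≢ p₀<p₁))

    flip₂ : FlipResult T₁ p₀ p₃ p₁ p₄ B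
    flip₂ = pair-flip T₁ (trans (F₁.kept p₀ p₃ p02≁p03 p13≁p03) p₀p₃-col) (sorted⇒cross p₀<p₁ p₁<p₃ p₃<p₄)
              (low-isDiag (subst₂ _<_ (cong suc (sym ν-p₁)) (sym ν-p₄) (n≤1+n _)) p₄≤h) (σ-inner≢low inner₁ p₄≤h ∘ sym)
              (side-kept {T} {T₁} (F₁.kept p₀ p₁ p02≁p01 p13≁p01) side₀₁) (inj₂ (col⇒support {lab T₁} F₁.flipped-label)) (inj₁ edge₃₄)
              (side-kept {T} {T₁} (F₁.kept p₄ p₀ p02≁p40 p13≁p40) (inj₂ S₄₀))
    module F₂ = FlipResult flip₂
    T₂ = F₂.T'

    p03≁p13 : ¬ SameSymPair p₀ p₃ p₁ p₃
    p03≁p13 = ¬sameSymPair-low (inj₂ inner₃) p₁≤h p₃≤h (inj₁ (<⇒≢ p₀<p₁)) (inj₁ (<⇒≢ p₀<p₃))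
    p14≁p13 : ¬ SameSymPair p₁ p₄ p₁ p₃
    p14≁p13 = ¬sameSymPair-low (inj₁ inner₁) p₁≤h p₃≤h (inj₂ (>⇒≢ p₃<p₄)) (inj₁ (<⇒≢ p₁<p₃))
    p03≁p40 : ¬ SameSymPair p₀ p₃ p₄ p₀
    p03≁p40 = ¬sameSymPair-low (inj₂ inner₃) p₄≤h p₀≤h (inj₁ (<⇒≢ p₀<p₄)) (inj₂ (<⇒≢ p₃<p₄))
    p14≁p40 : ¬ SameSymPair p₁ p₄ p₄ p₀
    p14≁p40 = ¬sameSymPair-low (inj₁ inner₁) p₄≤h p₀≤h (inj₁ (<⇒≢ p₁<p₄)) (inj₁ (>⇒≢ p₀<p₁))
    p03≁p01 : ¬ SameSymPair p₀ p₃ p₀ p₁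
    p03≁p01 = ¬sameSymPair-low (inj₂ inner₃) p₀≤h p₁≤h (inj₂ (>⇒≢ p₁<p₃)) (inj₁ (<⇒≢ p₀<p₁))
    p14≁p01 : ¬ SameSymPair p₁ p₄ p₀ p₁
    p14≁p01 = ¬sameSymPair-low (inj₁ inner₁) p₀≤h p₁≤h (inj₁ (>⇒≢ p₀<p₁)) (inj₂ (>⇒≢ p₀<p₄))

    flip₃ : FlipResult T₂ p₁ p₃ p₂ p₄ A
    flip₃ = pair-flip T₂ (trans (F₂.kept p₁ p₃ p03≁p13 p14≁p13) F₁.flipped-label) (sorted⇒cross p₁<p₂ p₂<p₃ p₃<p₄)
              (low-isDiag (subst₂ _<_ (cong suc (sym ν-p₂)) (sym ν-p₄) ≤-refl) p₄≤h) (σ-inner≢low inner₂ p₄≤h ∘ sym)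
              (inj₁ edge₁₂) (inj₁ edge₂₃) (inj₁ edge₃₄)
              (inj₂ (CST.support-sym (valid T₂) {p₁} {p₄} (col⇒support {lab T₂} F₂.flipped-label)))
    module F₃ = FlipResult flip₃
    T₃ = F₃.T'

    p13≁p14 : ¬ SameSymPair p₁ p₃ p₁ p₄
    p13≁p14 = ¬sameSymPair-low (inj₁ inner₁) p₁≤h p₄≤h (inj₂ (<⇒≢ p₃<p₄)) (inj₁ (<⇒≢ p₁<p₄))
    p24≁p14 : ¬ SameSymPair p₂ p₄ p₁ p₄
    p24≁p14 = ¬sameSymPair-low (inj₁ inner₂) p₁≤h p₄≤h (inj₁ (>⇒≢ p₁<p₂)) (inj₁ (<⇒≢ p₂<p₄))
    p24≁p40 : ¬ SameSymPair p₂ p₄ p₄ p₀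
    p24≁p40 = ¬sameSymPair-low (inj₁ inner₂) p₄≤h p₀≤h (inj₁ (<⇒≢ p₂<p₄)) (inj₁ (>⇒≢ p₀<p₂))
    p24≁p01 : ¬ SameSymPair p₂ p₄ p₀ p₁
    p24≁p01 = ¬sameSymPair-low (inj₁ inner₂) p₀≤h p₁≤h (inj₁ (>⇒≢ p₀<p₂)) (inj₁ (>⇒≢ p₁<p₂))

    side₄₀ : Side (Support (lab T₃)) p₄ p₀
    side₄₀ = side-kept {T₂} {T₃} (F₃.kept p₄ p₀ p13≁p40 p24≁p40)
               (side-kept {T₁} {T₂} (F₂.kept p₄ p₀ p03≁p40 p14≁p40) (side-kept {T} {T₁} (F₁.kept p₄ p₀ p02≁p40 p13≁p40) (inj₂ S₄₀)))

    flip₄ : FlipResult T₃ p₁ p₄ p₂ p₀ B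
    flip₄ = pair-flip T₃ (trans (F₃.kept p₁ p₄ p13≁p14 p24≁p14) F₂.flipped-label) (cross-swapʳ (cross-sym (sorted⇒cross p₀<p₁ p₁<p₂ p₂<p₄)))
              (isDiag-sym (low-isDiag (subst₂ _<_ (cong suc (sym ν-p₀)) (sym ν-p₂) (s≤s (s≤s z≤n))) p₂≤h)) (σ-inner≢low inner₂ p₀≤h ∘ sym)
              (inj₁ edge₁₂) (inj₂ (col⇒support {lab T₃} F₃.flipped-label)) side₄₀
              (side-kept {T₂} {T₃} (F₃.kept p₀ p₁ p13≁p01 p24≁p01)
                (side-kept {T₁} {T₂} (F₂.kept p₀ p₁ p03≁p01 p14≁p01) (side-kept {T} {T₁} (F₁.kept p₀ p₁ p02≁p01 p13≁p01) side₀₁)))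
    module F₄ = FlipResult flip₄
    T₄ = F₄.T'

    p14≁p24 : ¬ SameSymPair p₁ p₄ p₂ p₄
    p14≁p24 = ¬sameSymPair-low (inj₁ inner₁) p₂≤h p₄≤h (inj₁ (<⇒≢ p₁<p₂)) (inj₁ (<⇒≢ p₁<p₄))
    p20≁p24 : ¬ SameSymPair p₂ p₀ p₂ p₄
    p20≁p24 = ¬sameSymPair-low (inj₁ inner₂) p₂≤h p₄≤h (inj₂ (<⇒≢ p₀<p₄)) (inj₁ (<⇒≢ p₂<p₄))
    p20≁p40 : ¬ SameSymPair p₂ p₀ p₄ p₀
    p20≁p40 = ¬sameSymPair-low (inj₁ inner₂) p₄≤h p₀≤h (inj₁ (<⇒≢ p₂<p₄)) (inj₁ (>⇒≢ p₀<p₂))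

    flip₅ : FlipResult T₄ p₂ p₄ p₃ p₀ A
    flip₅ = pair-flip T₄ (trans (F₄.kept p₂ p₄ p14≁p24 p20≁p24) F₃.flipped-label) (cross-swapʳ (cross-sym (sorted⇒cross p₀<p₂ p₂<p₃ p₃<p₄)))
              (isDiag-sym (low-isDiag (subst₂ _<_ (cong suc (sym ν-p₀)) (sym ν-p₃) (s≤s (s≤s z≤n))) p₃≤h)) (σ-inner≢low inner₃ p₀≤h ∘ sym)
              (inj₁ edge₂₃) (inj₁ edge₃₄) (side-kept {T₃} {T₄} (F₄.kept p₄ p₀ p14≁p40 p20≁p40) side₄₀)
              (inj₂ (CST.support-sym (valid T₄) {p₂} {p₀} (col⇒support {lab T₄} F₄.flipped-label)))
    module F₅ = FlipResult flip₅
    T₅ = F₅.T'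

    p24≁p20 : ¬ SameSymPair p₂ p₄ p₂ p₀
    p24≁p20 = ¬sameSymPair-low (inj₁ inner₂) p₂≤h p₀≤h (inj₂ (>⇒≢ p₀<p₄)) (inj₁ (>⇒≢ p₀<p₂))
    p30≁p20 : ¬ SameSymPair p₃ p₀ p₂ p₀
    p30≁p20 = ¬sameSymPair-low (inj₁ inner₃) p₂≤h p₀≤h (inj₁ (>⇒≢ p₂<p₃)) (inj₁ (>⇒≢ p₀<p₃))

    reachable : Reachable T T₅
    reachable = reachable-trans F₁.reachable (reachable-trans F₂.reachable (reachable-trans F₃.reachable
                  (reachable-trans F₄.reachable F₅.reachable)))

    p₀p₂-col' : lab T₅ p₀ p₂ ≡ col B
    p₀p₂-col' = trans (CST.symmetric (valid T₅) p₀ p₂) (trans (F₅.kept p₂ p₀ p24≁p20 p30≁p20) F₄.flipped-label)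

    p₀p₃-col' : lab T₅ p₀ p₃ ≡ col A
    p₀p₃-col' = trans (CST.symmetric (valid T₅) p₀ p₃) F₅.flipped-label

    others-kept : ∀ z → ν z ≤ h → ν z ≢ ν p₂ → ν z ≢ ν p₃ → lab T₅ p₀ z ≡ lab T p₀ z
    others-kept z z≤h z≢p₂ z≢p₃ =
      trans (F₅.kept p₀ z (apart (inj₁ inner₂) (inj₁ (>⇒≢ p₀<p₂)) (inj₂ (>⇒≢ p₀<p₄)))
                          (apart (inj₁ inner₃) (inj₁ (>⇒≢ p₀<p₃)) (inj₁ (z≢p₃ ∘ sym))))
     (trans (F₄.kept p₀ z (apart (inj₁ inner₁) (inj₁ (>⇒≢ p₀<p₁)) (inj₂ (>⇒≢ p₀<p₄)))
                          (apart (inj₁ inner₂) (inj₁ (>⇒≢ p₀<p₂)) (inj₁ (z≢p₂ ∘ sym))))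
     (trans (F₃.kept p₀ z (apart (inj₁ inner₁) (inj₁ (>⇒≢ p₀<p₁)) (inj₂ (>⇒≢ p₀<p₃)))
                          (apart (inj₁ inner₂) (inj₁ (>⇒≢ p₀<p₂)) (inj₂ (>⇒≢ p₀<p₄))))
     (trans (F₂.kept p₀ z (apart (inj₂ inner₃) (inj₂ (z≢p₃ ∘ sym)) (inj₂ (>⇒≢ p₀<p₃)))
                          (apart (inj₁ inner₁) (inj₁ (>⇒≢ p₀<p₁)) (inj₂ (>⇒≢ p₀<p₄))))
            (F₁.kept p₀ z (apart (inj₂ inner₂) (inj₂ (z≢p₂ ∘ sym)) (inj₂ (>⇒≢ p₀<p₂)))
                          (apart (inj₁ inner₁) (inj₁ (>⇒≢ p₀<p₁)) (inj₂ (>⇒≢ p₀<p₃)))))))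
      where
      apart : ∀ {p q} → Inner p ⊎ Inner q → (ν p ≢ ν p₀ ⊎ ν q ≢ ν z) → (ν p ≢ ν z ⊎ ν q ≢ ν p₀) → ¬ SameSymPair p q p₀ z
      apart inner = ¬sameSymPair-low inner p₀≤h z≤h

    fan-kept : ∀ t → t < n → t ≢ j → t ≢ suc j → lab T₅ origin (fanVertex₀ t) ≡ lab T origin (fanVertex₀ t)
    fan-kept t t<n t≢j t≢1+j =
      others-kept (fanVertex₀ t) (subst (_≤ h) (sym (ν-fanVertex₀ t t<n)) (<⇒≤ (2+t<h t t<n)))
        (λ e → t≢j (+-cancelˡ-≡ 2 t j (trans (sym (ν-fanVertex₀ t t<n)) (trans e ν-p₂))))
        (λ e → t≢1+j (+-cancelˡ-≡ 2 t (suc j) (trans (sym (ν-fanVertex₀ t t<n)) (trans e ν-p₃))))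

    fan' : Fan₀ T₅
    fan' = central' , λ t t<n → fan-diagonal t t<n (t ≟ j) (t ≟ suc j)
      where
      central' : lab T₅ origin (σ origin) ≡ central
      central' = trans (others-kept (σ origin) (≤-reflexive ν-σ-origin)
                         (λ e → <-irrefl (sym e) (subst (ν p₂ <_) (sym ν-σ-origin) (<-≤-trans p₂<p₄ p₄≤h)))
                         (λ e → <-irrefl (sym e) (subst (ν p₃ <_) (sym ν-σ-origin) (<-≤-trans p₃<p₄ p₄≤h))))
                       (proj₁ fan)
      fan-diagonal : ∀ t → t < n → Dec (t ≡ j) → Dec (t ≡ suc j) → Support (lab T₅) origin (fanVertex₀ t)
      fan-diagonal t t<n (yes refl) _ = col⇒support {lab T₅} p₀p₂-col'
      fan-diagonal t t<n (no _) (yes refl) = col⇒support {lab T₅} p₀p₃-col'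
      fan-diagonal t t<n (no t≢j) (no t≢1+j) = S-fan t t<n ∘ trans (sym (fan-kept t t<n t≢j t≢1+j))

  -- Sorting the colors of a fan at vertex 0

  -- Labels other than colors get the junk value 0; only colors of fan diagonals are ever read.
  color : Label → ℕ
  color (col k) = toℕ k
  color none = 0
  color central = 0

  colorAt : ColoredCST → ℕ → ℕ
  colorAt T t = color (lab T origin (fanVertex₀ t))

  Sorted : ColoredCST → Set
  Sorted T = ∀ t → suc t < n → colorAt T t ≤ colorAt T (suc t)

  weight-colorAt-≤ : ∀ T → weight n (colorAt T) ≤ n * (n * n)
  weight-colorAt-≤ T = weight-≤ n n (colorAt T) ≤-refl (λ t _ → color≤n (lab T origin (fanVertex₀ t)))
    where
    color≤n : ∀ x → color x ≤ n
    color≤n (col k) = <⇒≤ (Fin.toℕ<n k)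
    color≤n none = z≤n
    color≤n central = z≤n

  -- Every exchange of an adjacent inversion strictly increases the weight, which is at most n³.
  sort : ∀ fuel T → Fan₀ T → n * (n * n) ≤ weight n (colorAt T) + fuel → ∃[ T' ] Reachable T T' × Fan₀ T' × Sorted T'
  sort fuel T fan bound = by-search (anyUpTo? (λ t → suc t <? n ×-dec colorAt T (suc t) <? colorAt T t) n)
    where
    by-search : Dec (∃ λ t → t < n × suc t < n × colorAt T (suc t) < colorAt T t) → ∃[ T' ] Reachable T T' × Fan₀ T' × Sorted T'
    by-search (no no-inversion) = T , reachable-refl {T} , fan ,
      λ t 1+t<n → ≮⇒≥ (λ inversion → no-inversion (t , <-trans (n<1+n t) 1+t<n , 1+t<n , inversion))
    by-search (yes (j , _ , 2+j≤n , inversion)) = continue fuel bound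
      where
      module X = Exchange T fan j 2+j≤n
      heavier : weight n (colorAt T) < weight n (colorAt X.T₅)
      heavier = weight-swap j n 2+j≤n (λ t t<n t≢j t≢1+j → cong color (X.fan-kept t t<n t≢j t≢1+j))
                  (cong color (trans X.p₀p₂-col' (sym X.p₀p₃-col))) (cong color (trans X.p₀p₃-col' (sym X.p₀p₂-col))) inversion
      continue : ∀ fuel → n * (n * n) ≤ weight n (colorAt T) + fuel → ∃[ T' ] Reachable T T' × Fan₀ T' × Sorted T'
      continue zero bound' = contradiction (<-≤-trans heavier (weight-colorAt-≤ X.T₅))
                                           (≤⇒≯ (subst (n * (n * n) ≤_) (+-identityʳ _) bound'))
      continue (suc fuel) bound' = prepend (sort fuel X.T₅ X.fan' (≤-trans bound' (≤-trans (≤-reflexive (+-suc _ fuel)) (+-monoˡ-≤ fuel heavier))))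
        where
        prepend : ∃[ T' ] Reachable X.T₅ T' × Fan₀ T' × Sorted T' → ∃[ T' ] Reachable T T' × Fan₀ T' × Sorted T'
        prepend (T' , T₅→T' , fan' , sorted') = T' , reachable-trans X.reachable T₅→T' , fan' , sorted'

  fanVertex₀≢σorigin : ∀ t → t < n → fanVertex₀ t ≢ σ origin
  fanVertex₀≢σorigin t t<n e = <-irrefl (trans (sym (ν-fanVertex₀ t t<n)) (trans (cong ν e) ν-σ-origin)) (2+t<h t t<n)

  fan-color : ∀ T → Fan₀ T → ∀ t → t < n → ∃[ k ] lab T origin (fanVertex₀ t) ≡ col k
  fan-color T fan t t<n = CST.support-col (valid T) (proj₂ fan t t<n) (fanVertex₀≢σorigin t t<n)

  colorAt≡ : ∀ T (fan : Fan₀ T) t (t<n : t < n) → colorAt T t ≡ toℕ (proj₁ (fan-color T fan t t<n))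
  colorAt≡ T fan t t<n = cong color (proj₂ (fan-color T fan t t<n))

  -- Distinct fan diagonals have distinct colors, since no two of them form a symmetric pair.
  colorAt-injective : ∀ T → Fan₀ T → ∀ t t' → t < n → t' < n → colorAt T t ≡ colorAt T t' → t ≡ t'
  colorAt-injective T fan t t' t<n t'<n same = decidable-stable (t ≟ t') (λ t≢t' → apart t≢t' symmetric-pair)
    where
    c = fan-color T fan t t<n
    c' = fan-color T fan t' t'<n
    symmetric-pair : SameSymPair origin (fanVertex₀ t) origin (fanVertex₀ t')
    symmetric-pair = CST.sameColor⇒sameSymPair (valid T) origin (fanVertex₀ t) origin (fanVertex₀ t') (proj₁ c) (proj₂ c)
      (trans (proj₂ c') (cong col (Fin.toℕ-injective (trans (sym (colorAt≡ T fan t' t'<n)) (trans (sym same) (colorAt≡ T fan t t<n))))))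
    apart : t ≢ t' → ¬ SameSymPair origin (fanVertex₀ t) origin (fanVertex₀ t')
    apart t≢t' = ¬sameSymPair-low (inj₂ (subst (0 <_) (sym (ν-fanVertex₀ t t<n)) (s≤s z≤n) , subst (_< h) (sym (ν-fanVertex₀ t t<n)) (2+t<h t t<n)))
                   (subst (_≤ h) (sym ν-origin) z≤n) (subst (_≤ h) (sym (ν-fanVertex₀ t' t'<n)) (<⇒≤ (2+t<h t' t'<n)))
                   (inj₂ (λ e → t≢t' (+-cancelˡ-≡ 2 t t' (trans (sym (ν-fanVertex₀ t t<n)) (trans e (ν-fanVertex₀ t' t'<n))))))
                   (inj₁ (λ e → case trans (sym ν-origin) (trans e (ν-fanVertex₀ t' t'<n)) of λ ()))

  sorted⇒colorAt≡id : ∀ T → Fan₀ T → Sorted T → ∀ t → t < n → colorAt T t ≡ t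
  sorted⇒colorAt≡id T fan sorted = increasing-bounded⇒id n (colorAt T) increasing bounded
    where
    increasing : ∀ t → suc t < n → colorAt T t < colorAt T (suc t)
    increasing t 1+t<n = ≤∧≢⇒< (sorted t 1+t<n) (λ e → <-irrefl (colorAt-injective T fan t (suc t) (<-trans (n<1+n t) 1+t<n) 1+t<n e) (n<1+n t))
    bounded : ∀ t → t < n → colorAt T t < n
    bounded t t<n = subst (_< n) (sym (colorAt≡ T fan t t<n)) (Fin.toℕ<n _)

  Canonical : ColoredCST → Set
  Canonical T = Fan₀ T × (∀ t → t < n → colorAt T t ≡ t)

  reach-canonical : ∀ T → ∃[ T' ] Reachable T T' × Canonical T'
  reach-canonical T = sorted (reach-fan₀ T)
    where
    sorted : ∃[ T₁ ] Reachable T T₁ × Fan₀ T₁ → ∃[ T' ] Reachable T T' × Canonical T'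
    sorted (T₁ , T→T₁ , fan₁) = canonical (sort (n * (n * n)) T₁ fan₁ (m≤n+m _ (weight n (colorAt T₁))))
      where
      canonical : ∃[ T' ] Reachable T₁ T' × Fan₀ T' × Sorted T' → ∃[ T' ] Reachable T T' × Canonical T'
      canonical (T' , T₁→T' , fan' , sorted') = T' , reachable-trans T→T₁ T₁→T' , fan' , sorted⇒colorAt≡id T' fan' sorted'

  canonical-unique : ∀ T T' → Canonical T → Canonical T' → SameCST T T'
  canonical-unique T T' (fan , colors) (fan' , colors') = fan₀-determined T T' fan fan' λ t t<n →
    trans (proj₂ (fan-color T fan t t<n))
      (trans (cong col (Fin.toℕ-injective (trans (sym (colorAt≡ T fan t t<n)) (trans (colors t t<n) (trans (sym (colors' t t<n)) (colorAt≡ T' fan' t t<n))))))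
             (sym (proj₂ (fan-color T' fan' t t<n))))

  connected : HcConnected
  connected T T' = through (reach-canonical T) (reach-canonical T')
    where
    through : ∃[ C ] Reachable T C × Canonical C → ∃[ C' ] Reachable T' C' × Canonical C' → Reachable T T'
    through (C , T→C , canonical-C) (C' , T'→C' , canonical-C') =
      reachable-trans T→C (reachable-trans (here (canonical-unique C C' canonical-C canonical-C')) (reachable-sym T'→C'))

lemma12 : ∀ (n : ℕ) → Polygon.HcConnected n
lemma12 n = Hc.connected n
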